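{- If $\mathcal{B}$ is an eulerian building set, then there is a polynomial $\Phi_{\mathcal{B}}(\mathbf{c},\mathbf{d})$ in the noncommuting variables $\mathbf{c}=\mathbf{a}+\mathbf{b}$ and $\mathbf{d}=\mathbf{a}\mathbf{b}+\mathbf{b}\mathbf{a}$ (the $\mathbf{c}\mathbf{d}$-index of $\mathcal{B}$) such that $\Psi_{\mathcal{B}}(\mathbf{a},\mathbf{b})=\Phi_{\mathcal{B}}(\mathbf{c},\mathbf{d})$.
   Context: A building set on a finite set $X$ is a collection $\mathcal{B}$ of nonempty subsets of $X$ such that (B1) if $S,S'\in\mathcal{B}$ and $S\cap S'\neq\emptyset$ then $S\cup S'\in\mathcal{B}$, and (B2) $\{i\}\in\mathcal{B}$ for all $i\in X$; its rank is $n=|X|$. Restriction: $\mathcal{B}|_I=\{S\in\mathcal{B}:S\subset I\}$; discrete means only singletons. For a composition $\alpha=(a_1,\dots,a_k)\models n$, $k(\alpha)=k$, $\zeta_\alpha(\mathcal{B})$ is the number of ordered decompositions $X=J_1\sqcup\dots\sqcup J_k$ with $|J_i|=a_i$ and each $\mathcal{B}|_{J_i}$ discrete, and $S(\alpha)=\{a_1,a_1+a_2,\dots,a_1+\dots+a_{k-1}\}\subset[n-1]$; $\beta\preceq\alpha$ means $S(\beta)\subset S(\alpha)$. Let $u_\alpha=u_{\alpha,1}\cdots u_{\alpha,n-1}$ be the word in noncommuting variables $\mathbf{a},\mathbf{b}$ with $u_{\alpha,i}=\mathbf{b}$ if $i\in S(\alpha)$ and $\mathbf{a}$ otherwise. The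 flag $h$-vector is $\eta_\alpha(\mathcal{B})=\sum_{\beta\preceq\alpha}(-1)^{k(\alpha)-k(\beta)}\zeta_\beta(\mathcal{B})$, and the $\mathbf{a}\mathbf{b}$-index is $\Psi_{\mathcal{B}}(\mathbf{a},\mathbf{b})=\sum_{\alpha\models n}\eta_\alpha(\mathcal{B})u_\alpha\in\mathbb{Q}\langle\mathbf{a},\mathbf{b}\rangle$. Let $\zeta^{ -1}(\mathcal{B}_\emptyset)=1$ and, for $X\ne\emptyset$, $\zeta^{ -1}(\mathcal{B}_X)=\sum_{k\ge1}(-1)^kN_k$, where $N_k$ is the number of ordered decompositions $X=J_1\sqcup\dots\sqcup J_k$ into nonempty sets with each $\mathcal{B}_X|_{J_i}$ discrete. A building set $\mathcal{B}_X$ is eulerian if for every $J\subset X$, either $\mathcal{B}_X|_J$ is discrete or $\zeta^{ -1}(\mathcal{B}_X|_J)=0$. -}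

module Defs where

open import Data.Bool using (Bool; true; false; _∧_; _∨_; not; if_then_else_)
open import Data.Nat using (ℕ; zero; suc; _+_; _∸_; _≤ᵇ_; _≡ᵇ_)
open import Data.List using (List; []; _∷_; map; concatMap; foldr; length; lookup; upTo; filterᵇ; _++_; applyUpTo)
open import Data.Bool.ListAction using (all; any)
open import Data.Nat.ListAction using (sum)
open import Data.Fin using (Fin)
open import Data.Fin.Subset using (Subset; inside; outside; _∩_; _∪_; ⁅_⁆; Nonempty; ∣_∣; ⊤)
open import Data.Fin.Properties using (_≟_)
open import Data.Maybe using (Maybe; nothing; just)
open import Data.Vec using (Vec; []; _∷_)
import Data.Vec as Vec
open import Data.List.Base using (allFin)
open import Data.Integer using (ℤ; +_; -_; _^_) renaming (_+_ to _+ℤ_; _*_ to _*ℤ_)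
open import Data.Rational using (ℚ; _/_) renaming (_+_ to _+ℚ_; _*_ to _*ℚ_; 0ℚ to 0q; 1ℚ to 1q)
open import Data.Product using (_×_; _,_)
open import Relation.Nullary.Decidable using (⌊_⌋)
open import Relation.Binary.PropositionalEquality using (_≡_)

allSubsets : (n : ℕ) → List (Subset n)
allSubsets zero    = [] ∷ []
allSubsets (suc n) = concatMap (λ s → (inside ∷ s) ∷ (outside ∷ s) ∷ []) (allSubsets n)

allVecs : {A : Set} → List A → (n : ℕ) → List (Vec A n)
allVecs xs zero    = [] ∷ []
allVecs xs (suc n) = concatMap (λ v → map (λ x → x ∷ v) xs) (allVecs xs n)

_⊆ᵇ_ : {n : ℕ} → Subset n → Subset n → Bool
[] ⊆ᵇ [] = true
(inside ∷ s) ⊆ᵇ (outside ∷ t) = false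
(_ ∷ s) ⊆ᵇ (_ ∷ t) = s ⊆ᵇ t

countᵇ : {A : Set} → (A → Bool) → List A → ℕ
countᵇ p xs = length (filterᵇ p xs)

_∈ℕᵇ_ : ℕ → List ℕ → Bool
x ∈ℕᵇ xs = any (λ y → x ≡ᵇ y) xs

sumℤ : List ℤ → ℤ
sumℤ = foldr _+ℤ_ (+ 0)

sumℚ : List ℚ → ℚ
sumℚ = foldr _+ℚ_ 0q

-- Building sets on X = Fin n, given by their (decidable) membership
-- predicate  B : Subset n → Bool  (S ∈ 𝓑  iff  B S ≡ true).

record IsBuildingSet {n : ℕ} (B : Subset n → Bool) : Set where
  field
    nonempty   : ∀ S → B S ≡ true → Nonempty S
    union      : ∀ S S′ → B S ≡ true → B S′ ≡ true → Nonempty (S ∩ S′) → B (S ∪ S′) ≡ true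
    singletons : ∀ i → B ⁅ i ⁆ ≡ true

-- 𝓑|_J is discrete: every S ∈ 𝓑 with S ⊆ J is a singleton
-- (members are nonempty, so "|S| ≤ 1" means "singleton").
discreteᵇ : {n : ℕ} → (Subset n → Bool) → Subset n → Bool
discreteᵇ {n} B J = all (λ S → not (B S ∧ (S ⊆ᵇ J)) ∨ (∣ S ∣ ≤ᵇ 1)) (allSubsets n)

Discrete : {n : ℕ} → (Subset n → Bool) → Subset n → Set
Discrete B J = discreteᵇ B J ≡ true

-- Ordered decompositions of J ⊆ Fin n into k blocks J_1 ⊔ … ⊔ J_k are
-- encoded by  g : Vec (Maybe (Fin k)) n  with  g x = just i  iff  x ∈ J_i,
-- and  g x = nothing  iff  x ∉ J.

isJustAt : {k : ℕ} → Fin k → Maybe (Fin k) → Bool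
isJustAt i nothing  = false
isJustAt i (just j) = ⌊ i ≟ j ⌋

isNothing : {A : Set} → Maybe A → Bool
isNothing nothing  = true
isNothing (just _) = false

block : {n k : ℕ} → Vec (Maybe (Fin k)) n → Fin k → Subset n
block g i = Vec.map (λ m → if isJustAt i m then inside else outside) g

memberᵇ : Bool → Bool
memberᵇ b = b

allAssignments : (n k : ℕ) → List (Vec (Maybe (Fin k)) n)
allAssignments n k = allVecs (nothing ∷ map just (allFin k)) n

-- g describes an ordered decomposition of J (blocks possibly empty)
-- with every 𝓑|_{J_i} discrete.
validDecomp : {n k : ℕ} → (Subset n → Bool) → Subset n → Vec (Maybe (Fin k)) n → Bool
validDecomp {n} {k} B J g =
  Vec.foldr (λ _ → Bool) _∧_ true
    (Vec.zipWith (λ m s → if isNothing m then not s else s) g J)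
  ∧ all (λ i → discreteᵇ B (block g i)) (allFin k)

Nₖ : {n : ℕ} → (Subset n → Bool) → Subset n → ℕ → ℕ
Nₖ {n} B J k =
  countᵇ (λ g → validDecomp B J g ∧ all (λ i → 1 ≤ᵇ ∣ block g i ∣) (allFin k))
         (allAssignments n k)

-- ζ^{-1}(𝓑|_J); the sum over k ≥ 1 is finite since N_k = 0 for k > |J|.
zetaInv : {n : ℕ} → (Subset n → Bool) → Subset n → ℤ
zetaInv B J with ∣ J ∣
... | zero  = + 1
... | suc m = sumℤ (map (λ k → ((- (+ 1)) ^ k) *ℤ (+ Nₖ B J k)) (applyUpTo suc (suc m)))

Eulerian : {n : ℕ} → (Subset n → Bool) → Set
Eulerian {n} B = ∀ (J : Subset n) → (Discrete B J) Data.Sum.⊎ (zetaInv B J ≡ + 0)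
  where import Data.Sum

compositionsF : ℕ → ℕ → List (List ℕ)
compositionsF _        zero    = [] ∷ []
compositionsF zero     (suc n) = []
compositionsF (suc f) (suc n) =
  concatMap (λ a → map (λ rest → suc a ∷ rest) (compositionsF f (n ∸ a))) (upTo (suc n))

compositions : ℕ → List (List ℕ)
compositions n = compositionsF n n

Sset : List ℕ → List ℕ
Sset []              = []
Sset (a ∷ [])        = []
Sset (a ∷ b ∷ rest)  = a ∷ map (λ x → a + x) (Sset (b ∷ rest))

_⪯ᵇ_ : List ℕ → List ℕ → Bool
β ⪯ᵇ α = all (λ x → x ∈ℕᵇ Sset α) (Sset β)

ζ : {n : ℕ} → (Subset n → Bool) → List ℕ → ℕ
ζ {n} B α =
  countᵇ (λ g → validDecomp B ⊤ g ∧ all (λ i → ∣ block g i ∣ ≡ᵇ lookup α i) (allFin (length α)))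
         (allAssignments n (length α))

η : {n : ℕ} → (Subset n → Bool) → List ℕ → ℤ
η {n} B α =
  sumℤ (map (λ β → ((- (+ 1)) ^ (length α ∸ length β)) *ℤ (+ ζ B β))
            (filterᵇ (λ β → β ⪯ᵇ α) (compositions n)))

data AB : Set where
  𝐚 𝐛 : AB

data CD : Set where
  𝐜 𝐝 : CD

_==AB_ : AB → AB → Bool
𝐚 ==AB 𝐚 = true
𝐛 ==AB 𝐛 = true
_ ==AB _ = false

_==W_ : List AB → List AB → Bool
[] ==W [] = true
(x ∷ xs) ==W (y ∷ ys) = (x ==AB y) ∧ (xs ==W ys)
_ ==W _ = false

NCPoly : Set → Set
NCPoly V = List (ℚ × List V)

coeff : NCPoly AB → List AB → ℚ
coeff p w = sumℚ (map (λ { (q , v) → if v ==W w then q else 0q }) p)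

_*P_ : NCPoly AB → NCPoly AB → NCPoly AB
p *P q = concatMap (λ { (c , u) → map (λ { (d , v) → (c *ℚ d , u ++ v) }) q }) p

expandVar : CD → NCPoly AB
expandVar 𝐜 = (1q , 𝐚 ∷ []) ∷ (1q , 𝐛 ∷ []) ∷ []
expandVar 𝐝 = (1q , 𝐚 ∷ 𝐛 ∷ []) ∷ (1q , 𝐛 ∷ 𝐚 ∷ []) ∷ []

expandMono : List CD → NCPoly AB
expandMono = foldr (λ x acc → expandVar x *P acc) ((1q , []) ∷ [])

expandCD : NCPoly CD → NCPoly AB
expandCD Φ = concatMap (λ { (q , m) → ((q , []) ∷ []) *P expandMono m }) Φ

uWord : List ℕ → List AB
uWord α = map (λ i → if i ∈ℕᵇ Sset α then 𝐛 else 𝐚) (applyUpTo suc (sum α ∸ 1))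

Ψ : {n : ℕ} → (Subset n → Bool) → NCPoly AB
Ψ {n} B = map (λ α → (η B α / 1 , uWord α)) (compositions n)

-- A set function on the subsets of X = Fin n is an element of
-- 𝔸 n = ℚ[x₀,…,xₙ₋₁]/(x₀²,…,xₙ₋₁²), its value at K being the coefficient of
-- x_K. Let Z = ∑ x_K over the nonempty K with 𝓑|_K discrete, and Z_a its
-- part of degree a. Then N_k(𝓑|_J) is the coefficient of x_J in Z^k and ζ_α
-- that of x_X in ∏ᵢ Z_{aᵢ}; so ζ⁻¹ is read off (1 + Z)⁻¹, and 𝓑 is eulerian
-- exactly when (1 + Z)⁻¹ = 1 + σ Z, where σ xᵢ = - xᵢ.
--
-- Write Ψ in the basis c = a + b, e = a - b. A run eʲ of a ce-word contributes
-- a homogeneous series h r j, and g = ∑ⱼ h 1 j solves (1 + ½ Z) g = Z. The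
-- eulerian identity turns this equation into σ g = - g, so the parts of g of
-- even degree vanish: a ce-word with a run of e's of odd length has coefficient
-- 0. The other ce-words are polynomials in c and e² = c² - 2d.

module Submission where

open import Defs
open import Data.Nat as ℕ using (ℕ; zero; suc; _+_; _∸_; _<_; _≤_; z≤n; s≤s; _≡ᵇ_; _≤ᵇ_)
import Data.Nat.Properties as ℕₚ
import Data.List.Properties as Listₚ
open import Data.Nat.ListAction using (sum)
open import Data.Integer as ℤ using (ℤ; +_)
import Data.Integer.Properties as ℤₚ
open import Data.Rational using (ℚ; 0ℚ; 1ℚ; ½; _/_; toℚᵘ; fromℚᵘ)
  renaming (_+_ to _+q_; _*_ to _*q_; -_ to -q_)
import Data.Rational.Properties as ℚₚ
import Data.Rational.Unnormalised as ℚᵘ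
import Data.Rational.Unnormalised.Properties as ℚᵘₚ
open import Data.Bool using (Bool; true; false; if_then_else_; _∧_; _∨_; not; T)
open import Data.Bool.Properties using (∧-zeroʳ)
open import Data.Bool.ListAction using (all)
open import Data.Fin using (Fin)
import Data.Fin as Fin
open import Data.Fin.Properties using (_≟_)
open import Data.Fin.Subset using (Subset; ∣_∣; ⊤) renaming (⊥ to ∅)
open import Data.Fin.Subset.Properties using (∣p∣≤n; ∣⊥∣≡0)
open import Data.List using (List; []; _∷_; _++_; map; concatMap; filterᵇ; length; applyUpTo; upTo;
  replicate; allFin; tabulate; lookup)
open import Data.List.Relation.Unary.All as All using (All; []; _∷_)
open import Data.Maybe using (Maybe; nothing; just)
open import Data.Product using (Σ; _×_; _,_; proj₁; proj₂)
open import Data.Sum using (inj₁; inj₂)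
open import Data.Unit using (tt) renaming (⊤ to Unit)
open import Data.Empty using (⊥-elim)
open import Data.Vec as Vec using (Vec; []; _∷_)
open import Function using (_∘_; id; case_of_)
open import Relation.Nullary using (¬_; Dec; yes; no)
open import Relation.Nullary.Decidable using (⌊_⌋; dec-true; dec-false)
open import Relation.Binary.PropositionalEquality
open import Algebra.Bundles using (CommutativeRing)
import Algebra.Consequences.Propositional as Consequences
import Algebra.Properties.Ring as RingProperties
import Algebra.Properties.Group as GroupProperties
import Algebra.Properties.CommutativeSemigroup as CommutativeSemigroupProperties

-- An element of 𝔸 (suc n) is a pair (a , b) standing for a + x₀ b, with
-- a, b in the variables x₁,…,xₙ; so the coefficient of x_K (K ⊆ Fin n)
-- sits at the leaf reached by following K, and 𝔸 0 = ℚ.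
𝔸 : ℕ → Set
𝔸 zero    = ℚ
𝔸 (suc n) = 𝔸 n × 𝔸 n

infixl 6 _⊕_
infixl 7 _⊗_
infix  9 ⊝_

_⊕_ : ∀ {n} → 𝔸 n → 𝔸 n → 𝔸 n
_⊕_ {zero}  x       y       = x +q y
_⊕_ {suc n} (a , b) (c , d) = a ⊕ c , b ⊕ d

_⊗_ : ∀ {n} → 𝔸 n → 𝔸 n → 𝔸 n
_⊗_ {zero}  x       y       = x *q y
_⊗_ {suc n} (a , b) (c , d) = a ⊗ c , a ⊗ d ⊕ b ⊗ c

⊝_ : ∀ {n} → 𝔸 n → 𝔸 n
⊝_ {zero}  x       = -q x
⊝_ {suc n} (a , b) = ⊝ a , ⊝ b

𝟘 : ∀ {n} → 𝔸 n
𝟘 {zero}  = 0ℚ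
𝟘 {suc n} = 𝟘 , 𝟘

const : ∀ {n} → ℚ → 𝔸 n
const {zero}  q = q
const {suc n} q = const q , 𝟘

𝟙 : ∀ {n} → 𝔸 n
𝟙 = const 1ℚ

⊕-assoc : ∀ {n} (x y z : 𝔸 n) → (x ⊕ y) ⊕ z ≡ x ⊕ (y ⊕ z)
⊕-assoc {zero}  x       y       z       = ℚₚ.+-assoc x y z
⊕-assoc {suc n} (a , b) (c , d) (e , f) = cong₂ _,_ (⊕-assoc a c e) (⊕-assoc b d f)

⊕-comm : ∀ {n} (x y : 𝔸 n) → x ⊕ y ≡ y ⊕ x
⊕-comm {zero}  x       y       = ℚₚ.+-comm x y
⊕-comm {suc n} (a , b) (c , d) = cong₂ _,_ (⊕-comm a c) (⊕-comm b d)

⊕-identityˡ : ∀ {n} (x : 𝔸 n) → 𝟘 ⊕ x ≡ x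
⊕-identityˡ {zero}  x       = ℚₚ.+-identityˡ x
⊕-identityˡ {suc n} (a , b) = cong₂ _,_ (⊕-identityˡ a) (⊕-identityˡ b)

⊕-identityʳ : ∀ {n} (x : 𝔸 n) → x ⊕ 𝟘 ≡ x
⊕-identityʳ x = trans (⊕-comm x 𝟘) (⊕-identityˡ x)

⊕-inverseˡ : ∀ {n} (x : 𝔸 n) → ⊝ x ⊕ x ≡ 𝟘
⊕-inverseˡ {zero}  x       = ℚₚ.+-inverseˡ x
⊕-inverseˡ {suc n} (a , b) = cong₂ _,_ (⊕-inverseˡ a) (⊕-inverseˡ b)

⊗-zeroˡ : ∀ {n} (x : 𝔸 n) → 𝟘 ⊗ x ≡ 𝟘
⊗-zeroˡ {zero}  x       = ℚₚ.*-zeroˡ x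
⊗-zeroˡ {suc n} (a , b) =
  cong₂ _,_ (⊗-zeroˡ a) (trans (cong₂ _⊕_ (⊗-zeroˡ b) (⊗-zeroˡ a)) (⊕-identityˡ 𝟘))

⊗-comm : ∀ {n} (x y : 𝔸 n) → x ⊗ y ≡ y ⊗ x
⊗-comm {zero}  x       y       = ℚₚ.*-comm x y
⊗-comm {suc n} (a , b) (c , d) = cong₂ _,_ (⊗-comm a c)
  (trans (cong₂ _⊕_ (⊗-comm a d) (⊗-comm b c)) (⊕-comm (d ⊗ a) (c ⊗ b)))

⊕-interchange : ∀ {n} (p q r s : 𝔸 n) → (p ⊕ q) ⊕ (r ⊕ s) ≡ (p ⊕ r) ⊕ (q ⊕ s)
⊕-interchange p q r s = begin
  (p ⊕ q) ⊕ (r ⊕ s)  ≡⟨ ⊕-assoc p q (r ⊕ s) ⟩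
  p ⊕ (q ⊕ (r ⊕ s))  ≡⟨ cong (p ⊕_) (sym (⊕-assoc q r s)) ⟩
  p ⊕ ((q ⊕ r) ⊕ s)  ≡⟨ cong (λ t → p ⊕ (t ⊕ s)) (⊕-comm q r) ⟩
  p ⊕ ((r ⊕ q) ⊕ s)  ≡⟨ cong (p ⊕_) (⊕-assoc r q s) ⟩
  p ⊕ (r ⊕ (q ⊕ s))  ≡⟨ sym (⊕-assoc p r (q ⊕ s)) ⟩
  (p ⊕ r) ⊕ (q ⊕ s)  ∎
  where open ≡-Reasoning

⊗-distribˡ : ∀ {n} (x y z : 𝔸 n) → x ⊗ (y ⊕ z) ≡ x ⊗ y ⊕ x ⊗ z
⊗-distribˡ {zero}  x       y       z       = ℚₚ.*-distribˡ-+ x y z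
⊗-distribˡ {suc n} (a , b) (c , d) (e , f) = cong₂ _,_ (⊗-distribˡ a c e) (begin
  a ⊗ (d ⊕ f) ⊕ b ⊗ (c ⊕ e)          ≡⟨ cong₂ _⊕_ (⊗-distribˡ a d f) (⊗-distribˡ b c e) ⟩
  (a ⊗ d ⊕ a ⊗ f) ⊕ (b ⊗ c ⊕ b ⊗ e)  ≡⟨ ⊕-interchange (a ⊗ d) (a ⊗ f) (b ⊗ c) (b ⊗ e) ⟩
  (a ⊗ d ⊕ b ⊗ c) ⊕ (a ⊗ f ⊕ b ⊗ e)  ∎)
  where open ≡-Reasoning

⊗-distribʳ : ∀ {n} (x y z : 𝔸 n) → (y ⊕ z) ⊗ x ≡ y ⊗ x ⊕ z ⊗ x
⊗-distribʳ x y z = trans (⊗-comm (y ⊕ z) x)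
  (trans (⊗-distribˡ x y z) (cong₂ _⊕_ (⊗-comm x y) (⊗-comm x z)))

⊗-identityˡ : ∀ {n} (x : 𝔸 n) → 𝟙 ⊗ x ≡ x
⊗-identityˡ {zero}  x       = ℚₚ.*-identityˡ x
⊗-identityˡ {suc n} (a , b) = cong₂ _,_ (⊗-identityˡ a)
  (trans (cong₂ _⊕_ (⊗-identityˡ b) (⊗-zeroˡ a)) (⊕-identityʳ b))

⊗-assoc : ∀ {n} (x y z : 𝔸 n) → (x ⊗ y) ⊗ z ≡ x ⊗ (y ⊗ z)
⊗-assoc {zero}  x       y       z       = ℚₚ.*-assoc x y z
⊗-assoc {suc n} (a , b) (c , d) (e , f) = cong₂ _,_ (⊗-assoc a c e) (begin
  (a ⊗ c) ⊗ f ⊕ (a ⊗ d ⊕ b ⊗ c) ⊗ e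
    ≡⟨ cong₂ _⊕_ (⊗-assoc a c f) (⊗-distribʳ e (a ⊗ d) (b ⊗ c)) ⟩
  a ⊗ (c ⊗ f) ⊕ ((a ⊗ d) ⊗ e ⊕ (b ⊗ c) ⊗ e)
    ≡⟨ cong₂ (λ u v → a ⊗ (c ⊗ f) ⊕ (u ⊕ v)) (⊗-assoc a d e) (⊗-assoc b c e) ⟩
  a ⊗ (c ⊗ f) ⊕ (a ⊗ (d ⊗ e) ⊕ b ⊗ (c ⊗ e))
    ≡⟨ sym (⊕-assoc (a ⊗ (c ⊗ f)) (a ⊗ (d ⊗ e)) (b ⊗ (c ⊗ e))) ⟩
  (a ⊗ (c ⊗ f) ⊕ a ⊗ (d ⊗ e)) ⊕ b ⊗ (c ⊗ e)
    ≡⟨ cong (_⊕ b ⊗ (c ⊗ e)) (sym (⊗-distribˡ a (c ⊗ f) (d ⊗ e))) ⟩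
  a ⊗ (c ⊗ f ⊕ d ⊗ e) ⊕ b ⊗ (c ⊗ e)  ∎)
  where open ≡-Reasoning

𝔸-commutativeRing : ℕ → CommutativeRing _ _
𝔸-commutativeRing n = record
  { Carrier = 𝔸 n ; _≈_ = _≡_ ; _+_ = _⊕_ ; _*_ = _⊗_ ; -_ = ⊝_ ; 0# = 𝟘 ; 1# = 𝟙
  ; isCommutativeRing = record
    { isRing = record
      { +-isAbelianGroup = record
        { isGroup = record
          { isMonoid = record
            { isSemigroup = record
              { isMagma = record { isEquivalence = isEquivalence ; ∙-cong = cong₂ _⊕_ }
              ; assoc = ⊕-assoc }
            ; identity = ⊕-identityˡ , ⊕-identityʳ }
          ; inverse = ⊕-inverseˡ , Consequences.comm∧invˡ⇒invʳ ⊕-comm ⊕-inverseˡ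
          ; ⁻¹-cong = cong ⊝_ }
        ; comm = ⊕-comm }
      ; *-cong = cong₂ _⊗_
      ; *-assoc = ⊗-assoc
      ; *-identity = Consequences.comm∧idˡ⇒id ⊗-comm ⊗-identityˡ
      ; distrib = ⊗-distribˡ , ⊗-distribʳ }
    ; *-comm = ⊗-comm } }

module 𝔸-Properties {n : ℕ} where
  open CommutativeRing (𝔸-commutativeRing n) public
    using (zeroʳ) renaming (-‿inverseʳ to ⊕-inverseʳ; *-identityʳ to ⊗-identityʳ)
  open RingProperties (CommutativeRing.ring (𝔸-commutativeRing n)) public
    using (-‿distribˡ-*; -‿distribʳ-*; -‿+-comm)
  open GroupProperties (CommutativeRing.+-group (𝔸-commutativeRing n)) public
    using (inverseˡ-unique; inverseʳ-unique; ⁻¹-involutive; ε⁻¹≈ε)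
  open CommutativeSemigroupProperties (CommutativeRing.*-commutativeSemigroup (𝔸-commutativeRing n)) public
    using () renaming (x∙yz≈y∙xz to ⊗-swap; interchange to ⊗-interchange)

open 𝔸-Properties public

infixl 9 _at_

_at_ : ∀ {n} → 𝔸 n → Subset n → ℚ
_at_ {zero}  x       []          = x
_at_ {suc n} (a , b) (false ∷ K) = a at K
_at_ {suc n} (a , b) (true ∷ K)  = b at K

fromCoeffs : ∀ {n} → (Subset n → ℚ) → 𝔸 n
fromCoeffs {zero}  f = f []
fromCoeffs {suc n} f = fromCoeffs (f ∘ (false ∷_)) , fromCoeffs (f ∘ (true ∷_))

fromCoeffs-at : ∀ {n} (f : Subset n → ℚ) K → fromCoeffs f at K ≡ f K
fromCoeffs-at {zero}  f []          = refl
fromCoeffs-at {suc n} f (false ∷ K) = fromCoeffs-at (f ∘ (false ∷_)) K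
fromCoeffs-at {suc n} f (true ∷ K)  = fromCoeffs-at (f ∘ (true ∷_)) K

coeff-ext : ∀ {n} {x y : 𝔸 n} → (∀ K → x at K ≡ y at K) → x ≡ y
coeff-ext {zero}  {x}     {y}     h = h []
coeff-ext {suc n} {a , b} {c , d} h =
  cong₂ _,_ (coeff-ext (h ∘ (false ∷_))) (coeff-ext (h ∘ (true ∷_)))

at-⊕ : ∀ {n} (x y : 𝔸 n) K → (x ⊕ y) at K ≡ x at K +q y at K
at-⊕ {zero}  x       y       []          = refl
at-⊕ {suc n} (a , b) (c , d) (false ∷ K) = at-⊕ a c K
at-⊕ {suc n} (a , b) (c , d) (true ∷ K)  = at-⊕ b d K

at-⊝ : ∀ {n} (x : 𝔸 n) K → (⊝ x) at K ≡ -q (x at K)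
at-⊝ {zero}  x       []          = refl
at-⊝ {suc n} (a , b) (false ∷ K) = at-⊝ a K
at-⊝ {suc n} (a , b) (true ∷ K)  = at-⊝ b K

at-𝟘 : ∀ {n} K → 𝟘 {n} at K ≡ 0ℚ
at-𝟘 []          = refl
at-𝟘 (false ∷ K) = at-𝟘 K
at-𝟘 (true ∷ K)  = at-𝟘 K

at-𝟙 : ∀ {n} (K : Subset n) → 𝟙 at K ≡ (if ∣ K ∣ ≡ᵇ 0 then 1ℚ else 0ℚ)
at-𝟙 []          = refl
at-𝟙 (false ∷ K) = at-𝟙 K
at-𝟙 (true ∷ K)  = at-𝟘 K

at-const⊗ : ∀ {n} q (x : 𝔸 n) K → (const q ⊗ x) at K ≡ q *q x at K
at-const⊗ {zero}  q x       []          = refl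
at-const⊗ {suc n} q (a , b) (false ∷ K) = at-const⊗ q a K
at-const⊗ {suc n} q (a , b) (true ∷ K)  = begin
  (const q ⊗ b ⊕ 𝟘 ⊗ a) at K   ≡⟨ cong (λ t → (const q ⊗ b ⊕ t) at K) (⊗-zeroˡ a) ⟩
  (const q ⊗ b ⊕ 𝟘) at K       ≡⟨ cong (_at K) (⊕-identityʳ _) ⟩
  (const q ⊗ b) at K           ≡⟨ at-const⊗ q b K ⟩
  q *q b at K                  ∎
  where open ≡-Reasoning

const-+ : ∀ {n} p q → const {n} (p +q q) ≡ const p ⊕ const q
const-+ {zero}  p q = refl
const-+ {suc n} p q = cong₂ _,_ (const-+ p q) (sym (⊕-identityˡ 𝟘))

const-* : ∀ {n} p q → const {n} (p *q q) ≡ const p ⊗ const q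
const-* {zero}  p q = refl
const-* {suc n} p q = cong₂ _,_ (const-* p q)
  (sym (trans (cong₂ _⊕_ (zeroʳ (const p)) (⊗-zeroˡ (const q))) (⊕-identityˡ 𝟘)))

const-0 : ∀ {n} → const {n} 0ℚ ≡ 𝟘
const-0 {zero}  = refl
const-0 {suc n} = cong (_, 𝟘) const-0

-- The ring automorphism xᵢ ↦ - xᵢ.
σ : ∀ {n} → 𝔸 n → 𝔸 n
σ {zero}  x       = x
σ {suc n} (a , b) = σ a , ⊝ σ b

sign : ℕ → ℚ
sign zero    = 1ℚ
sign (suc k) = -q sign k

σ-⊕ : ∀ {n} (x y : 𝔸 n) → σ (x ⊕ y) ≡ σ x ⊕ σ y
σ-⊕ {zero}  x       y       = refl
σ-⊕ {suc n} (a , b) (c , d) =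
  cong₂ _,_ (σ-⊕ a c) (trans (cong ⊝_ (σ-⊕ b d)) (sym (-‿+-comm (σ b) (σ d))))

σ-⊗ : ∀ {n} (x y : 𝔸 n) → σ (x ⊗ y) ≡ σ x ⊗ σ y
σ-⊗ {zero}  x       y       = refl
σ-⊗ {suc n} (a , b) (c , d) = cong₂ _,_ (σ-⊗ a c) (begin
  ⊝ σ (a ⊗ d ⊕ b ⊗ c)            ≡⟨ cong ⊝_ (σ-⊕ (a ⊗ d) (b ⊗ c)) ⟩
  ⊝ (σ (a ⊗ d) ⊕ σ (b ⊗ c))      ≡⟨ sym (-‿+-comm (σ (a ⊗ d)) (σ (b ⊗ c))) ⟩
  ⊝ σ (a ⊗ d) ⊕ ⊝ σ (b ⊗ c)      ≡⟨ cong₂ (λ u v → ⊝ u ⊕ ⊝ v) (σ-⊗ a d) (σ-⊗ b c) ⟩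
  ⊝ (σ a ⊗ σ d) ⊕ ⊝ (σ b ⊗ σ c)  ≡⟨ cong₂ _⊕_ (-‿distribʳ-* (σ a) (σ d)) (-‿distribˡ-* (σ b) (σ c)) ⟩
  σ a ⊗ ⊝ σ d ⊕ ⊝ σ b ⊗ σ c      ∎)
  where open ≡-Reasoning

σ-𝟘 : ∀ {n} → σ (𝟘 {n}) ≡ 𝟘
σ-𝟘 {zero}  = refl
σ-𝟘 {suc n} = cong₂ _,_ σ-𝟘 (trans (cong ⊝_ σ-𝟘) ε⁻¹≈ε)

σ-const : ∀ {n} q → σ (const {n} q) ≡ const q
σ-const {zero}  q = refl
σ-const {suc n} q = cong₂ _,_ (σ-const q) (trans (cong ⊝_ σ-𝟘) ε⁻¹≈ε)

at-σ : ∀ {n} (x : 𝔸 n) K → σ x at K ≡ sign ∣ K ∣ *q x at K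
at-σ {zero}  x       []          = sym (ℚₚ.*-identityˡ x)
at-σ {suc n} (a , b) (false ∷ K) = at-σ a K
at-σ {suc n} (a , b) (true ∷ K)  = begin
  (⊝ σ b) at K                ≡⟨ at-⊝ (σ b) K ⟩
  -q (σ b at K)               ≡⟨ cong -q_ (at-σ b K) ⟩
  -q (sign ∣ K ∣ *q b at K)   ≡⟨ ℚₚ.neg-distribˡ-* (sign ∣ K ∣) (b at K) ⟩
  sign (suc ∣ K ∣) *q b at K  ∎
  where open ≡-Reasoning

c₀ : ∀ {n} → 𝔸 n → ℚ
c₀ {zero}  x       = x
c₀ {suc n} (a , b) = c₀ a

c₀-⊕ : ∀ {n} (x y : 𝔸 n) → c₀ (x ⊕ y) ≡ c₀ x +q c₀ y
c₀-⊕ {zero}  x       y       = refl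
c₀-⊕ {suc n} (a , b) (c , d) = c₀-⊕ a c

c₀-⊗ : ∀ {n} (x y : 𝔸 n) → c₀ (x ⊗ y) ≡ c₀ x *q c₀ y
c₀-⊗ {zero}  x       y       = refl
c₀-⊗ {suc n} (a , b) (c , d) = c₀-⊗ a c

c₀-const : ∀ {n} q → c₀ (const {n} q) ≡ q
c₀-const {zero}  q = refl
c₀-const {suc n} q = c₀-const {n} q

c₀-σ : ∀ {n} (x : 𝔸 n) → c₀ (σ x) ≡ c₀ x
c₀-σ {zero}  x       = refl
c₀-σ {suc n} (a , b) = c₀-σ a

c₀-at : ∀ {n} (x : 𝔸 n) → c₀ x ≡ x at ∅
c₀-at {zero}  x       = refl
c₀-at {suc n} (a , b) = c₀-at a

⊗-cancelˡ-𝟘 : ∀ {n} (y x : 𝔸 n) → c₀ y ≡ 1ℚ → y ⊗ x ≡ 𝟘 → x ≡ 𝟘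
⊗-cancelˡ-𝟘 {zero}  y       x       c₀y≡1 yx≡0 =
  trans (sym (ℚₚ.*-identityˡ x)) (trans (cong (_*q x) (sym c₀y≡1)) yx≡0)
⊗-cancelˡ-𝟘 {suc n} (a , b) (c , d) c₀y≡1 yx≡0 = cong₂ _,_ c≡0 (⊗-cancelˡ-𝟘 a d c₀y≡1 (begin
  a ⊗ d              ≡⟨ sym (⊕-identityʳ _) ⟩
  a ⊗ d ⊕ 𝟘          ≡⟨ cong (a ⊗ d ⊕_) (sym (zeroʳ b)) ⟩
  a ⊗ d ⊕ b ⊗ 𝟘      ≡⟨ cong (λ t → a ⊗ d ⊕ b ⊗ t) (sym c≡0) ⟩
  a ⊗ d ⊕ b ⊗ c      ≡⟨ cong proj₂ yx≡0 ⟩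
  𝟘                  ∎))
  where
  open ≡-Reasoning
  c≡0 : c ≡ 𝟘
  c≡0 = ⊗-cancelˡ-𝟘 a c c₀y≡1 (cong proj₁ yx≡0)

⊗-cancelˡ : ∀ {n} (y : 𝔸 n) {x x′} → c₀ y ≡ 1ℚ → y ⊗ x ≡ y ⊗ x′ → x ≡ x′
⊗-cancelˡ y {x} {x′} c₀y≡1 yx≡yx′ = begin
  x                ≡⟨ inverseˡ-unique x (⊝ x′) x-x′≡0 ⟩
  ⊝ ⊝ x′           ≡⟨ ⁻¹-involutive x′ ⟩
  x′               ∎
  where
  open ≡-Reasoning
  x-x′≡0 : x ⊕ ⊝ x′ ≡ 𝟘
  x-x′≡0 = ⊗-cancelˡ-𝟘 y (x ⊕ ⊝ x′) c₀y≡1 (begin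
    y ⊗ (x ⊕ ⊝ x′)        ≡⟨ ⊗-distribˡ y x (⊝ x′) ⟩
    y ⊗ x ⊕ y ⊗ ⊝ x′      ≡⟨ cong₂ _⊕_ yx≡yx′ (sym (-‿distribʳ-* y x′)) ⟩
    y ⊗ x′ ⊕ ⊝ (y ⊗ x′)   ≡⟨ ⊕-inverseʳ (y ⊗ x′) ⟩
    𝟘                     ∎)

⊗-inverse-unique : ∀ {n} (y x x′ : 𝔸 n) → y ⊗ x ≡ 𝟙 → y ⊗ x′ ≡ 𝟙 → x ≡ x′
⊗-inverse-unique y x x′ yx≡1 yx′≡1 = begin
  x                ≡⟨ sym (⊗-identityˡ x) ⟩
  𝟙 ⊗ x            ≡⟨ cong (_⊗ x) (sym yx′≡1) ⟩
  (y ⊗ x′) ⊗ x     ≡⟨ cong (_⊗ x) (⊗-comm y x′) ⟩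
  (x′ ⊗ y) ⊗ x     ≡⟨ ⊗-assoc x′ y x ⟩
  x′ ⊗ (y ⊗ x)     ≡⟨ cong (x′ ⊗_) yx≡1 ⟩
  x′ ⊗ 𝟙           ≡⟨ ⊗-identityʳ x′ ⟩
  x′               ∎
  where open ≡-Reasoning

restrict : ∀ {n} → Subset n → 𝔸 n → 𝔸 n
restrict {zero}  []          x       = x
restrict {suc n} (false ∷ K) (a , b) = restrict K a , 𝟘
restrict {suc n} (true ∷ K)  (a , b) = restrict K a , restrict K b

restrict-𝟘 : ∀ {n} (K : Subset n) → restrict K 𝟘 ≡ 𝟘
restrict-𝟘 []          = refl
restrict-𝟘 (false ∷ K) = cong (_, 𝟘) (restrict-𝟘 K)
restrict-𝟘 (true ∷ K)  = cong₂ _,_ (restrict-𝟘 K) (restrict-𝟘 K)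

restrict-𝟙 : ∀ {n} (K : Subset n) → restrict K 𝟙 ≡ 𝟙
restrict-𝟙 []          = refl
restrict-𝟙 (false ∷ K) = cong (_, 𝟘) (restrict-𝟙 K)
restrict-𝟙 (true ∷ K)  = cong₂ _,_ (restrict-𝟙 K) (restrict-𝟘 K)

restrict-⊕ : ∀ {n} (K : Subset n) x y → restrict K (x ⊕ y) ≡ restrict K x ⊕ restrict K y
restrict-⊕ []          x       y       = refl
restrict-⊕ (false ∷ K) (a , b) (c , d) = cong₂ _,_ (restrict-⊕ K a c) (sym (⊕-identityˡ 𝟘))
restrict-⊕ (true ∷ K)  (a , b) (c , d) = cong₂ _,_ (restrict-⊕ K a c) (restrict-⊕ K b d)

restrict-⊗ : ∀ {n} (K : Subset n) x y → restrict K (x ⊗ y) ≡ restrict K x ⊗ restrict K y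
restrict-⊗ []          x       y       = refl
restrict-⊗ (false ∷ K) (a , b) (c , d) = cong₂ _,_ (restrict-⊗ K a c)
  (sym (trans (cong₂ _⊕_ (zeroʳ (restrict K a)) (⊗-zeroˡ (restrict K c))) (⊕-identityˡ 𝟘)))
restrict-⊗ (true ∷ K)  (a , b) (c , d) = cong₂ _,_ (restrict-⊗ K a c)
  (trans (restrict-⊕ K (a ⊗ d) (b ⊗ c)) (cong₂ _⊕_ (restrict-⊗ K a d) (restrict-⊗ K b c)))

at-restrict : ∀ {n} (K : Subset n) x L → restrict K x at L ≡ (if L ⊆ᵇ K then x at L else 0ℚ)
at-restrict []          x       []          = refl
at-restrict (false ∷ K) (a , b) (false ∷ L) = at-restrict K a L
at-restrict (false ∷ K) (a , b) (true ∷ L)  = at-𝟘 L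
at-restrict (true ∷ K)  (a , b) (false ∷ L) = at-restrict K a L
at-restrict (true ∷ K)  (a , b) (true ∷ L)  = at-restrict K b L

⊆ᵇ-refl : ∀ {n} (K : Subset n) → K ⊆ᵇ K ≡ true
⊆ᵇ-refl []          = refl
⊆ᵇ-refl (false ∷ K) = ⊆ᵇ-refl K
⊆ᵇ-refl (true ∷ K)  = ⊆ᵇ-refl K

at-restrict-self : ∀ {n} (K : Subset n) x → restrict K x at K ≡ x at K
at-restrict-self K x rewrite at-restrict K x K | ⊆ᵇ-refl K = refl

all-ones : ∀ {n} → 𝔸 n
all-ones {zero}  = 1ℚ
all-ones {suc n} = all-ones , all-ones

at-all-ones : ∀ {n} (K : Subset n) → all-ones at K ≡ 1ℚ
at-all-ones []          = refl
at-all-ones (false ∷ K) = at-all-ones K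
at-all-ones (true ∷ K)  = at-all-ones K

all-ones⊗σall-ones : ∀ {n} → all-ones {n} ⊗ σ all-ones ≡ 𝟙
all-ones⊗σall-ones {zero}  = refl
all-ones⊗σall-ones {suc n} = cong₂ _,_ all-ones⊗σall-ones (begin
  U ⊗ ⊝ σ U ⊕ U ⊗ σ U     ≡⟨ ⊕-comm _ _ ⟩
  U ⊗ σ U ⊕ U ⊗ ⊝ σ U     ≡⟨ cong (U ⊗ σ U ⊕_) (sym (-‿distribʳ-* U (σ U))) ⟩
  U ⊗ σ U ⊕ ⊝ (U ⊗ σ U)   ≡⟨ ⊕-inverseʳ (U ⊗ σ U) ⟩
  𝟘                       ∎)
  where
  open ≡-Reasoning
  U = all-ones {n}

Homogeneous : ∀ {n} → ℕ → 𝔸 n → Set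
Homogeneous {zero}  zero    x       = Unit
Homogeneous {zero}  (suc d) x       = x ≡ 0ℚ
Homogeneous {suc n} zero    (a , b) = Homogeneous zero a × b ≡ 𝟘
Homogeneous {suc n} (suc d) (a , b) = Homogeneous (suc d) a × Homogeneous d b

Homogeneous-𝟘 : ∀ {n} d → Homogeneous {n} d 𝟘
Homogeneous-𝟘 {zero}  zero    = tt
Homogeneous-𝟘 {zero}  (suc d) = refl
Homogeneous-𝟘 {suc n} zero    = Homogeneous-𝟘 zero , refl
Homogeneous-𝟘 {suc n} (suc d) = Homogeneous-𝟘 (suc d) , Homogeneous-𝟘 d

Homogeneous-⊕ : ∀ {n} d {x y : 𝔸 n} → Homogeneous d x → Homogeneous d y → Homogeneous d (x ⊕ y)
Homogeneous-⊕ {zero}  zero    hx hy = tt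
Homogeneous-⊕ {zero}  (suc d) hx hy = cong₂ _+q_ hx hy
Homogeneous-⊕ {suc n} zero    (ha , refl) (hc , refl) = Homogeneous-⊕ zero ha hc , ⊕-identityˡ 𝟘
Homogeneous-⊕ {suc n} (suc d) (ha , hb)   (hc , he)   = Homogeneous-⊕ (suc d) ha hc , Homogeneous-⊕ d hb he

Homogeneous-const : ∀ {n} q → Homogeneous {n} 0 (const q)
Homogeneous-const {zero}  q = tt
Homogeneous-const {suc n} q = Homogeneous-const q , refl

Homogeneous-⊗ : ∀ {n} d e {x y : 𝔸 n} → Homogeneous d x → Homogeneous e y → Homogeneous (d + e) (x ⊗ y)
Homogeneous-⊗ {zero}  zero    zero    hx hy = tt
Homogeneous-⊗ {zero}  zero    (suc e) {x} hx hy = trans (cong (x *q_) hy) (ℚₚ.*-zeroʳ x)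
Homogeneous-⊗ {zero}  (suc d) e {y = y} hx hy = trans (cong (_*q y) hx) (ℚₚ.*-zeroˡ y)
Homogeneous-⊗ {suc n} zero zero {a , _} {c , _} (ha , refl) (hc , refl) =
  Homogeneous-⊗ zero zero ha hc , trans (cong₂ _⊕_ (zeroʳ a) (⊗-zeroˡ c)) (⊕-identityˡ 𝟘)
Homogeneous-⊗ {suc n} zero (suc e) {a , _} {c , f} (ha , refl) (hc , hf) =
  Homogeneous-⊗ zero (suc e) ha hc ,
  Homogeneous-⊕ e (Homogeneous-⊗ zero e ha hf) (subst (Homogeneous e) (sym (⊗-zeroˡ c)) (Homogeneous-𝟘 e))
Homogeneous-⊗ {suc n} (suc d) zero {a , b} {c , _} (ha , hb) (hc , refl) =
  Homogeneous-⊗ (suc d) zero ha hc ,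
  Homogeneous-⊕ (d + zero) (subst (Homogeneous (d + zero)) (sym (zeroʳ a)) (Homogeneous-𝟘 _))
    (Homogeneous-⊗ d zero hb hc)
Homogeneous-⊗ {suc n} (suc d) (suc e) {a , b} {c , f} (ha , hb) (hc , hf) =
  Homogeneous-⊗ (suc d) (suc e) ha hc ,
  Homogeneous-⊕ (d + suc e)
    (subst (λ k → Homogeneous k (a ⊗ f)) (sym (ℕₚ.+-suc d e)) (Homogeneous-⊗ (suc d) e ha hf))
    (Homogeneous-⊗ d (suc e) hb hc)

Homogeneous⇒at≡0 : ∀ {n} d {x : 𝔸 n} K → Homogeneous d x → ¬ ∣ K ∣ ≡ d → x at K ≡ 0ℚ
Homogeneous⇒at≡0 {zero}  zero    []          h           ∣K∣≢d = ⊥-elim (∣K∣≢d refl)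
Homogeneous⇒at≡0 {zero}  (suc d) []          h           ∣K∣≢d = h
Homogeneous⇒at≡0 {suc n} zero    (false ∷ K) (ha , hb)   ∣K∣≢d = Homogeneous⇒at≡0 zero K ha ∣K∣≢d
Homogeneous⇒at≡0 {suc n} zero    (true ∷ K)  (ha , refl) ∣K∣≢d = at-𝟘 K
Homogeneous⇒at≡0 {suc n} (suc d) (false ∷ K) (ha , hb)   ∣K∣≢d = Homogeneous⇒at≡0 (suc d) K ha ∣K∣≢d
Homogeneous⇒at≡0 {suc n} (suc d) (true ∷ K)  (ha , hb)   ∣K∣≢d = Homogeneous⇒at≡0 d K hb (∣K∣≢d ∘ cong suc)

Homogeneous-fromCoeffs : ∀ {n} d (f : Subset n → ℚ) → (∀ K → ¬ ∣ K ∣ ≡ d → f K ≡ 0ℚ) →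
                         Homogeneous d (fromCoeffs f)
Homogeneous-fromCoeffs {zero}  zero    f h = tt
Homogeneous-fromCoeffs {zero}  (suc d) f h = h [] (λ ())
Homogeneous-fromCoeffs {suc n} zero    f h =
  Homogeneous-fromCoeffs zero _ (h ∘ (false ∷_)) ,
  coeff-ext (λ K → trans (fromCoeffs-at _ K) (trans (h (true ∷ K) (λ ())) (sym (at-𝟘 K))))
Homogeneous-fromCoeffs {suc n} (suc d) f h =
  Homogeneous-fromCoeffs (suc d) _ (h ∘ (false ∷_)) ,
  Homogeneous-fromCoeffs d _ (λ K ∣K∣≢d → h (true ∷ K) (∣K∣≢d ∘ ℕₚ.suc-injective))

Homogeneous⇒≡𝟘 : ∀ {n} d {x : 𝔸 n} → n < d → Homogeneous d x → x ≡ 𝟘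
Homogeneous⇒≡𝟘 d n<d h = coeff-ext λ K →
  trans (Homogeneous⇒at≡0 d K h (ℕₚ.<⇒≢ (ℕₚ.≤-<-trans (∣p∣≤n K) n<d))) (sym (at-𝟘 K))

Order≥ : ∀ {n} → ℕ → 𝔸 n → Set
Order≥ {zero}  zero    x       = Unit
Order≥ {zero}  (suc d) x       = x ≡ 0ℚ
Order≥ {suc n} zero    (a , b) = Unit
Order≥ {suc n} (suc d) (a , b) = Order≥ (suc d) a × Order≥ d b

Order≥-0 : ∀ {n} (x : 𝔸 n) → Order≥ 0 x
Order≥-0 {zero}  x = tt
Order≥-0 {suc n} x = tt

Order≥-⊕ : ∀ {n} d {x y : 𝔸 n} → Order≥ d x → Order≥ d y → Order≥ d (x ⊕ y)
Order≥-⊕ {zero}  zero    hx hy = tt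
Order≥-⊕ {zero}  (suc d) hx hy = cong₂ _+q_ hx hy
Order≥-⊕ {suc n} zero    hx hy = tt
Order≥-⊕ {suc n} (suc d) (ha , hb) (hc , he) = Order≥-⊕ (suc d) ha hc , Order≥-⊕ d hb he

Order≥-suc : ∀ {n} d {x : 𝔸 n} → Order≥ (suc d) x → Order≥ d x
Order≥-suc {zero}  zero    h = tt
Order≥-suc {zero}  (suc d) h = h
Order≥-suc {suc n} zero    h = tt
Order≥-suc {suc n} (suc d) (ha , hb) = Order≥-suc (suc d) ha , Order≥-suc d hb

Order≥-⊗ : ∀ {n} d e {x y : 𝔸 n} → Order≥ d x → Order≥ e y → Order≥ (d + e) (x ⊗ y)
Order≥-⊗ {zero}  zero    zero    hx hy = tt
Order≥-⊗ {zero}  zero    (suc e) {x} hx hy = trans (cong (x *q_) hy) (ℚₚ.*-zeroʳ x)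
Order≥-⊗ {zero}  (suc d) e {y = y} hx hy = trans (cong (_*q y) hx) (ℚₚ.*-zeroˡ y)
Order≥-⊗ {suc n} zero    zero    hx hy = tt
Order≥-⊗ {suc n} zero (suc e) {a , b} {c , f} hx (hc , hf) =
  Order≥-⊗ zero (suc e) (Order≥-0 a) hc ,
  Order≥-⊕ e (Order≥-⊗ zero e (Order≥-0 a) hf) (Order≥-suc e (Order≥-⊗ zero (suc e) (Order≥-0 b) hc))
Order≥-⊗ {suc n} (suc d) zero {a , b} {c , f} (ha , hb) hy =
  Order≥-⊗ (suc d) zero ha (Order≥-0 c) ,
  Order≥-⊕ (d + zero) (Order≥-suc (d + zero) (Order≥-⊗ (suc d) zero ha (Order≥-0 f)))
    (Order≥-⊗ d zero hb (Order≥-0 c))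
Order≥-⊗ {suc n} (suc d) (suc e) {a , b} {c , f} (ha , hb) (hc , hf) =
  Order≥-⊗ (suc d) (suc e) ha hc ,
  Order≥-⊕ (d + suc e)
    (subst (λ k → Order≥ k (a ⊗ f)) (sym (ℕₚ.+-suc d e)) (Order≥-⊗ (suc d) e ha hf))
    (Order≥-⊗ d (suc e) hb hc)

Order≥⇒at≡0 : ∀ {n} d {x : 𝔸 n} K → Order≥ d x → ∣ K ∣ < d → x at K ≡ 0ℚ
Order≥⇒at≡0 {zero}  (suc d) []          h         ∣K∣<d       = h
Order≥⇒at≡0 {suc n} (suc d) (false ∷ K) (ha , hb) ∣K∣<d       = Order≥⇒at≡0 (suc d) K ha ∣K∣<d
Order≥⇒at≡0 {suc n} (suc d) (true ∷ K)  (ha , hb) (s≤s ∣K∣<d) = Order≥⇒at≡0 d K hb ∣K∣<d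

Order≥-fromCoeffs : ∀ {n} d (f : Subset n → ℚ) → (∀ K → ∣ K ∣ < d → f K ≡ 0ℚ) → Order≥ d (fromCoeffs f)
Order≥-fromCoeffs {zero}  zero    f h = tt
Order≥-fromCoeffs {zero}  (suc d) f h = h [] (s≤s z≤n)
Order≥-fromCoeffs {suc n} zero    f h = tt
Order≥-fromCoeffs {suc n} (suc d) f h =
  Order≥-fromCoeffs (suc d) _ (h ∘ (false ∷_)) , Order≥-fromCoeffs d _ (λ K ∣K∣<d → h (true ∷ K) (s≤s ∣K∣<d))

Order≥⇒≡𝟘 : ∀ {n} d {x : 𝔸 n} → n < d → Order≥ d x → x ≡ 𝟘
Order≥⇒≡𝟘 d n<d h = coeff-ext λ K →
  trans (Order≥⇒at≡0 d K h (ℕₚ.≤-<-trans (∣p∣≤n K) n<d)) (sym (at-𝟘 K))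

∑ : ∀ {n} {A : Set} → List A → (A → 𝔸 n) → 𝔸 n
∑ []       f = 𝟘
∑ (x ∷ xs) f = f x ⊕ ∑ xs f

∑ℚ : {A : Set} → List A → (A → ℚ) → ℚ
∑ℚ = ∑ {0}

module _ {n : ℕ} {A : Set} where

  ∑-cong : (xs : List A) {f g : A → 𝔸 n} → (∀ x → f x ≡ g x) → ∑ xs f ≡ ∑ xs g
  ∑-cong []       h = refl
  ∑-cong (x ∷ xs) h = cong₂ _⊕_ (h x) (∑-cong xs h)

  ∑-++ : (xs ys : List A) (f : A → 𝔸 n) → ∑ (xs ++ ys) f ≡ ∑ xs f ⊕ ∑ ys f
  ∑-++ []       ys f = sym (⊕-identityˡ _)
  ∑-++ (x ∷ xs) ys f = trans (cong (f x ⊕_) (∑-++ xs ys f)) (sym (⊕-assoc _ _ _))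

  ∑-⊕ : (xs : List A) (f g : A → 𝔸 n) → ∑ xs (λ x → f x ⊕ g x) ≡ ∑ xs f ⊕ ∑ xs g
  ∑-⊕ []       f g = sym (⊕-identityˡ _)
  ∑-⊕ (x ∷ xs) f g = trans (cong (f x ⊕ g x ⊕_) (∑-⊕ xs f g)) (⊕-interchange _ _ _ _)

  ∑-⊗ˡ : (xs : List A) (y : 𝔸 n) (f : A → 𝔸 n) → ∑ xs (λ x → y ⊗ f x) ≡ y ⊗ ∑ xs f
  ∑-⊗ˡ []       y f = sym (zeroʳ y)
  ∑-⊗ˡ (x ∷ xs) y f = trans (cong (y ⊗ f x ⊕_) (∑-⊗ˡ xs y f)) (sym (⊗-distribˡ y _ _))

  ∑-⊗ʳ : (xs : List A) (y : 𝔸 n) (f : A → 𝔸 n) → ∑ xs (λ x → f x ⊗ y) ≡ ∑ xs f ⊗ y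
  ∑-⊗ʳ xs y f = trans (∑-cong xs (λ x → ⊗-comm (f x) y)) (trans (∑-⊗ˡ xs y f) (⊗-comm y _))

  ∑-𝟘 : (xs : List A) {f : A → 𝔸 n} → (∀ x → f x ≡ 𝟘) → ∑ xs f ≡ 𝟘
  ∑-𝟘 []       h = refl
  ∑-𝟘 (x ∷ xs) h = trans (cong₂ _⊕_ (h x) (∑-𝟘 xs h)) (⊕-identityˡ 𝟘)

  ∑-filterᵇ : (p : A → Bool) (xs : List A) (f : A → 𝔸 n) →
              ∑ (filterᵇ p xs) f ≡ ∑ xs (λ x → if p x then f x else 𝟘)
  ∑-filterᵇ p []       f = refl
  ∑-filterᵇ p (x ∷ xs) f with p x
  ... | true  = cong (f x ⊕_) (∑-filterᵇ p xs f)
  ... | false = trans (∑-filterᵇ p xs f) (sym (⊕-identityˡ _))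

∑-map : ∀ {n} {A B : Set} (g : A → B) (xs : List A) (f : B → 𝔸 n) → ∑ (map g xs) f ≡ ∑ xs (f ∘ g)
∑-map g []       f = refl
∑-map g (x ∷ xs) f = cong (f (g x) ⊕_) (∑-map g xs f)

∑-concatMap : ∀ {n} {A B : Set} (g : A → List B) (xs : List A) (f : B → 𝔸 n) →
              ∑ (concatMap g xs) f ≡ ∑ xs (λ x → ∑ (g x) f)
∑-concatMap g []       f = refl
∑-concatMap g (x ∷ xs) f = trans (∑-++ (g x) (concatMap g xs) f) (cong (∑ (g x) f ⊕_) (∑-concatMap g xs f))

∑-comm : ∀ {n} {A B : Set} (xs : List A) (ys : List B) (f : A → B → 𝔸 n) →
         ∑ xs (λ x → ∑ ys (f x)) ≡ ∑ ys (λ y → ∑ xs (λ x → f x y))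
∑-comm []       ys f = sym (∑-𝟘 ys (λ _ → refl))
∑-comm (x ∷ xs) ys f = trans (cong (∑ ys (f x) ⊕_) (∑-comm xs ys f)) (sym (∑-⊕ ys (f x) _))

at-∑ : ∀ {n} {A : Set} (xs : List A) (f : A → 𝔸 n) K → ∑ xs f at K ≡ ∑ℚ xs (λ x → f x at K)
at-∑ []       f K = at-𝟘 K
at-∑ (x ∷ xs) f K = trans (at-⊕ (f x) _ K) (cong (f x at K +q_) (at-∑ xs f K))

∏ᶠ : ∀ {n} (k : ℕ) → (Fin k → 𝔸 n) → 𝔸 n
∏ᶠ zero    f = 𝟙
∏ᶠ (suc k) f = f Fin.zero ⊗ ∏ᶠ k (f ∘ Fin.suc)

∑ᶠ : ∀ {n} (k : ℕ) → (Fin k → 𝔸 n) → 𝔸 n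
∑ᶠ zero    f = 𝟘
∑ᶠ (suc k) f = f Fin.zero ⊕ ∑ᶠ k (f ∘ Fin.suc)

∏ᶠ-cong : ∀ {n} k {f g : Fin k → 𝔸 n} → (∀ i → f i ≡ g i) → ∏ᶠ k f ≡ ∏ᶠ k g
∏ᶠ-cong zero    h = refl
∏ᶠ-cong (suc k) h = cong₂ _⊗_ (h Fin.zero) (∏ᶠ-cong k (h ∘ Fin.suc))

∑ᶠ-cong : ∀ {n} k {f g : Fin k → 𝔸 n} → (∀ i → f i ≡ g i) → ∑ᶠ k f ≡ ∑ᶠ k g
∑ᶠ-cong zero    h = refl
∑ᶠ-cong (suc k) h = cong₂ _⊕_ (h Fin.zero) (∑ᶠ-cong k (h ∘ Fin.suc))

∑ᶠ-⊗ˡ : ∀ {n} k (y : 𝔸 n) (f : Fin k → 𝔸 n) → ∑ᶠ k (λ i → y ⊗ f i) ≡ y ⊗ ∑ᶠ k f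
∑ᶠ-⊗ˡ zero    y f = sym (zeroʳ y)
∑ᶠ-⊗ˡ (suc k) y f = trans (cong (y ⊗ f Fin.zero ⊕_) (∑ᶠ-⊗ˡ k y _)) (sym (⊗-distribˡ y _ _))

∑ᶠ-∑ : ∀ {n} {A : Set} k (xs : List A) (f : Fin k → A → 𝔸 n) →
       ∑ᶠ k (λ i → ∑ xs (f i)) ≡ ∑ xs (λ x → ∑ᶠ k (λ i → f i x))
∑ᶠ-∑ zero    xs f = sym (∑-𝟘 xs (λ _ → refl))
∑ᶠ-∑ (suc k) xs f = trans (cong (∑ xs (f Fin.zero) ⊕_) (∑ᶠ-∑ k xs (f ∘ Fin.suc))) (sym (∑-⊕ xs _ _))

at-∑ᶠ : ∀ {n} k (f : Fin k → 𝔸 n) K → ∑ᶠ k f at K ≡ ∑ᶠ {0} k (λ i → f i at K)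
at-∑ᶠ zero    f K = at-𝟘 K
at-∑ᶠ (suc k) f K = trans (at-⊕ (f Fin.zero) _ K) (cong (f Fin.zero at K +q_) (at-∑ᶠ k _ K))

∑-tabulate : ∀ {n} {A : Set} k (g : Fin k → A) (f : A → 𝔸 n) → ∑ (tabulate g) f ≡ ∑ᶠ k (f ∘ g)
∑-tabulate zero    g f = refl
∑-tabulate (suc k) g f = cong (f (g Fin.zero) ⊕_) (∑-tabulate k (g ∘ Fin.suc) f)

∏ᶠ-⊗ : ∀ {n} k (f g : Fin k → 𝔸 n) → ∏ᶠ k f ⊗ ∏ᶠ k g ≡ ∏ᶠ k (λ i → f i ⊗ g i)
∏ᶠ-⊗ zero    f g = ⊗-identityˡ 𝟙
∏ᶠ-⊗ (suc k) f g = trans (⊗-interchange (f Fin.zero) (∏ᶠ k (f ∘ Fin.suc)) (g Fin.zero) (∏ᶠ k (g ∘ Fin.suc)))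
                           (cong ((f Fin.zero ⊗ g Fin.zero) ⊗_) (∏ᶠ-⊗ k (f ∘ Fin.suc) (g ∘ Fin.suc)))

∑-applyUpTo : ∀ {n} {A : Set} (g : ℕ → A) L (f : A → 𝔸 n) → ∑ (applyUpTo g L) f ≡ ∑ (upTo L) (f ∘ g)
∑-applyUpTo g L f = trans (cong (λ l → ∑ l f) (sym (Listₚ.map-upTo g L))) (∑-map g (upTo L) f)

∑-applyUpTo-suc : ∀ {n} {A : Set} (g : ℕ → A) L (f : A → 𝔸 n) →
                  ∑ (applyUpTo g (suc L)) f ≡ ∑ (applyUpTo g L) f ⊕ f (g L)
∑-applyUpTo-suc g L f = begin
  ∑ (applyUpTo g (suc L)) f            ≡⟨ cong (λ l → ∑ l f) (sym (Listₚ.applyUpTo-∷ʳ g L)) ⟩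
  ∑ (applyUpTo g L ++ g L ∷ []) f      ≡⟨ ∑-++ (applyUpTo g L) _ f ⟩
  ∑ (applyUpTo g L) f ⊕ (f (g L) ⊕ 𝟘)  ≡⟨ cong (∑ (applyUpTo g L) f ⊕_) (⊕-identityʳ (f (g L))) ⟩
  ∑ (applyUpTo g L) f ⊕ f (g L)        ∎
  where open ≡-Reasoning

∑-upTo-truncate : ∀ {n} (f : ℕ → 𝔸 n) {c} L → c ≤ L → (∀ k → c ≤ k → f k ≡ 𝟘) → ∑ (upTo L) f ≡ ∑ (upTo c) f
∑-upTo-truncate f zero z≤n h = refl
∑-upTo-truncate f {c} (suc L) c≤1+L h with c ℕ.≟ suc L
... | yes refl   = refl
... | no c≢1+L = begin
  ∑ (upTo (suc L)) f    ≡⟨ ∑-applyUpTo-suc id L f ⟩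
  ∑ (upTo L) f ⊕ f L    ≡⟨ cong (∑ (upTo L) f ⊕_) (h L c≤L) ⟩
  ∑ (upTo L) f ⊕ 𝟘      ≡⟨ ⊕-identityʳ _ ⟩
  ∑ (upTo L) f          ≡⟨ ∑-upTo-truncate f L c≤L h ⟩
  ∑ (upTo c) f          ∎
  where
  open ≡-Reasoning
  c≤L = ℕₚ.≤-pred (ℕₚ.≤∧≢⇒< c≤1+L c≢1+L)

∑ℚ-upTo-single : ∀ (f : ℕ → ℚ) {j} L → j < L → (∀ i → ¬ i ≡ j → f i ≡ 0ℚ) → ∑ℚ (upTo L) f ≡ f j
∑ℚ-upTo-single f {zero}  (suc L) _ h = begin
  f 0 +q ∑ℚ (applyUpTo suc L) f    ≡⟨ cong (f 0 +q_) (trans (∑-applyUpTo suc L f)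
                                        (∑-𝟘 (upTo L) (λ i → h (suc i) (λ ())))) ⟩
  f 0 +q 0ℚ                        ≡⟨ ℚₚ.+-identityʳ (f 0) ⟩
  f 0                              ∎
  where open ≡-Reasoning
∑ℚ-upTo-single f {suc j} (suc L) (s≤s j<L) h = begin
  f 0 +q ∑ℚ (applyUpTo suc L) f    ≡⟨ cong₂ _+q_ (h 0 (λ ())) (∑-applyUpTo suc L f) ⟩
  0ℚ +q ∑ℚ (upTo L) (f ∘ suc)      ≡⟨ ℚₚ.+-identityˡ _ ⟩
  ∑ℚ (upTo L) (f ∘ suc)            ≡⟨ ∑ℚ-upTo-single (f ∘ suc) L j<L (λ i i≢j → h (suc i) (i≢j ∘ ℕₚ.suc-injective)) ⟩
  f (suc j)                        ∎
  where open ≡-Reasoning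

∑-telescope : ∀ {n} (t a : ℕ → 𝔸 n) → (∀ r → t r ≡ a r ⊕ t (suc r)) →
              ∀ R → t 1 ≡ ∑ (applyUpTo suc R) a ⊕ t (suc R)
∑-telescope t a step zero    = sym (⊕-identityˡ (t 1))
∑-telescope t a step (suc R) = begin
  t 1                                                   ≡⟨ ∑-telescope t a step R ⟩
  ∑ (applyUpTo suc R) a ⊕ t (suc R)                     ≡⟨ cong (∑ (applyUpTo suc R) a ⊕_) (step (suc R)) ⟩
  ∑ (applyUpTo suc R) a ⊕ (a (suc R) ⊕ t (suc (suc R))) ≡⟨ sym (⊕-assoc _ _ _) ⟩
  (∑ (applyUpTo suc R) a ⊕ a (suc R)) ⊕ t (suc (suc R)) ≡⟨ cong (_⊕ t (suc (suc R))) (sym (∑-applyUpTo-suc suc R a)) ⟩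
  ∑ (applyUpTo suc (suc R)) a ⊕ t (suc (suc R))         ∎
  where open ≡-Reasoning

infixr 8 _^_

_^_ : ∀ {n} → 𝔸 n → ℕ → 𝔸 n
x ^ k = ∏ᶠ k (λ _ → x)

ι : ℤ → ℚ
ι a = a / 1

ι-+ : ∀ a b → ι (a ℤ.+ b) ≡ ι a +q ι b
ι-+ a b = sym (trans (sym (ℚₚ.fromℚᵘ-toℚᵘ (ι a +q ι b))) (ℚₚ.fromℚᵘ-cong toℚᵘ-sum))
  where
  toℚᵘ-sum : toℚᵘ (ι a +q ι b) ℚᵘ.≃ ℚᵘ.mkℚᵘ (a ℤ.+ b) 0
  toℚᵘ-sum = ℚᵘₚ.≃-trans (ℚₚ.toℚᵘ-homo-+ (ι a) (ι b))
    (ℚᵘₚ.≃-trans (ℚᵘₚ.+-cong (ℚₚ.toℚᵘ-fromℚᵘ (ℚᵘ.mkℚᵘ a 0)) (ℚₚ.toℚᵘ-fromℚᵘ (ℚᵘ.mkℚᵘ b 0)))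
    (ℚᵘ.*≡* (cong (ℤ._* + 1) (cong₂ ℤ._+_ (ℤₚ.*-identityʳ a) (ℤₚ.*-identityʳ b)))))

ι-* : ∀ a b → ι (a ℤ.* b) ≡ ι a *q ι b
ι-* a b = sym (trans (sym (ℚₚ.fromℚᵘ-toℚᵘ (ι a *q ι b))) (ℚₚ.fromℚᵘ-cong toℚᵘ-product))
  where
  toℚᵘ-product : toℚᵘ (ι a *q ι b) ℚᵘ.≃ ℚᵘ.mkℚᵘ (a ℤ.* b) 0
  toℚᵘ-product = ℚᵘₚ.≃-trans (ℚₚ.toℚᵘ-homo-* (ι a) (ι b))
    (ℚᵘₚ.≃-trans (ℚᵘₚ.*-cong (ℚₚ.toℚᵘ-fromℚᵘ (ℚᵘ.mkℚᵘ a 0)) (ℚₚ.toℚᵘ-fromℚᵘ (ℚᵘ.mkℚᵘ b 0)))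
    (ℚᵘ.*≡* refl))

ι-sumℤ : {A : Set} (h : A → ℤ) (xs : List A) → ι (sumℤ (map h xs)) ≡ ∑ℚ xs (ι ∘ h)
ι-sumℤ h []       = refl
ι-sumℤ h (x ∷ xs) = trans (ι-+ (h x) _) (cong (ι (h x) +q_) (ι-sumℤ h xs))

ι-sign : ∀ k → ι ((ℤ.- + 1) ℤ.^ k) ≡ sign k
ι-sign zero    = refl
ι-sign (suc k) = begin
  ι ((ℤ.- + 1) ℤ.* (ℤ.- + 1) ℤ.^ k)  ≡⟨ ι-* (ℤ.- + 1) ((ℤ.- + 1) ℤ.^ k) ⟩
  -q 1ℚ *q ι ((ℤ.- + 1) ℤ.^ k)        ≡⟨ cong (-q 1ℚ *q_) (ι-sign k) ⟩
  -q 1ℚ *q sign k                     ≡⟨ sym (ℚₚ.neg-distribˡ-* 1ℚ (sign k)) ⟩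
  -q (1ℚ *q sign k)                   ≡⟨ cong -q_ (ℚₚ.*-identityˡ (sign k)) ⟩
  sign (suc k)                        ∎
  where open ≡-Reasoning

𝟙ᵇ : Bool → ℚ
𝟙ᵇ true  = 1ℚ
𝟙ᵇ false = 0ℚ

𝟙ᵇ-∧ : ∀ a b → 𝟙ᵇ (a ∧ b) ≡ 𝟙ᵇ a *q 𝟙ᵇ b
𝟙ᵇ-∧ true  b = sym (ℚₚ.*-identityˡ (𝟙ᵇ b))
𝟙ᵇ-∧ false b = sym (ℚₚ.*-zeroˡ (𝟙ᵇ b))

𝟙ᵇ-all-tabulate : {A : Set} (k : ℕ) (g : Fin k → A) (p : A → Bool) →
                  𝟙ᵇ (all p (tabulate g)) ≡ ∏ᶠ {0} k (λ i → 𝟙ᵇ (p (g i)))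
𝟙ᵇ-all-tabulate zero    g p = refl
𝟙ᵇ-all-tabulate (suc k) g p =
  trans (𝟙ᵇ-∧ (p (g Fin.zero)) _) (cong (𝟙ᵇ (p (g Fin.zero)) *q_) (𝟙ᵇ-all-tabulate k (g ∘ Fin.suc) p))

ι-count : {A : Set} (p : A → Bool) (xs : List A) → ι (+ length (filterᵇ p xs)) ≡ ∑ℚ xs (𝟙ᵇ ∘ p)
ι-count p []       = refl
ι-count p (x ∷ xs) with p x
... | true  = trans (ι-+ (+ 1) (+ length (filterᵇ p xs))) (cong (1ℚ +q_) (ι-count p xs))
... | false = trans (ι-count p xs) (sym (ℚₚ.+-identityˡ _))

∑ℚ-𝟙ᵇ-≡ᵇ : ∀ c L → c ≤ L → ∑ℚ (applyUpTo suc L) (λ r → 𝟙ᵇ (c ≡ᵇ r)) ≡ 𝟙ᵇ (1 ≤ᵇ c)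
∑ℚ-𝟙ᵇ-≡ᵇ zero    L       _         = trans (∑-applyUpTo suc L _) (∑-𝟘 (upTo L) (λ _ → refl))
∑ℚ-𝟙ᵇ-≡ᵇ (suc c) (suc L) (s≤s c≤L) = begin
  𝟙ᵇ (c ≡ᵇ 0) +q ∑ℚ (applyUpTo (suc ∘ suc) L) (λ r → 𝟙ᵇ (suc c ≡ᵇ r))
    ≡⟨ cong (𝟙ᵇ (c ≡ᵇ 0) +q_) (trans (∑-applyUpTo (suc ∘ suc) L _) (sym (∑-applyUpTo suc L _))) ⟩
  𝟙ᵇ (c ≡ᵇ 0) +q ∑ℚ (applyUpTo suc L) (λ r → 𝟙ᵇ (c ≡ᵇ r))
    ≡⟨ cong (𝟙ᵇ (c ≡ᵇ 0) +q_) (∑ℚ-𝟙ᵇ-≡ᵇ c L c≤L) ⟩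
  𝟙ᵇ (c ≡ᵇ 0) +q 𝟙ᵇ (1 ≤ᵇ c)
    ≡⟨ by-size c ⟩
  1ℚ  ∎
  where
  open ≡-Reasoning
  by-size : ∀ c → 𝟙ᵇ (c ≡ᵇ 0) +q 𝟙ᵇ (1 ≤ᵇ c) ≡ 1ℚ
  by-size zero    = refl
  by-size (suc c) = refl

even : ℕ → Bool
even zero          = true
even (suc zero)    = false
even (suc (suc k)) = even k

even-suc : ∀ j → even (suc j) ≡ not (even j)
even-suc zero          = refl
even-suc (suc zero)    = refl
even-suc (suc (suc j)) = even-suc j

sign-even : ∀ k → even k ≡ true → sign k ≡ 1ℚ
sign-even zero          _      = refl
sign-even (suc (suc k)) even-k = trans (⁻¹-involutive {0} (sign k)) (sign-even k even-k)

x≡-x⇒x≡0 : ∀ x → x ≡ -q x → x ≡ 0ℚ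
x≡-x⇒x≡0 x x≡-x = begin
  x                  ≡⟨ sym (ℚₚ.*-identityˡ x) ⟩
  (½ +q ½) *q x      ≡⟨ ℚₚ.*-distribʳ-+ x ½ ½ ⟩
  ½ *q x +q ½ *q x   ≡⟨ sym (ℚₚ.*-distribˡ-+ ½ x x) ⟩
  ½ *q (x +q x)      ≡⟨ cong (λ t → ½ *q (x +q t)) x≡-x ⟩
  ½ *q (x +q -q x)   ≡⟨ cong (½ *q_) (ℚₚ.+-inverseʳ x) ⟩
  ½ *q 0ℚ            ≡⟨ ℚₚ.*-zeroʳ ½ ⟩
  0ℚ                 ∎
  where open ≡-Reasoning

-- Inverting 1 + x

Order≥-⊝ : ∀ {n} d {x : 𝔸 n} → Order≥ d x → Order≥ d (⊝ x)
Order≥-⊝ {zero}  zero    h         = tt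
Order≥-⊝ {zero}  (suc d) h         = cong -q_ h
Order≥-⊝ {suc n} zero    h         = tt
Order≥-⊝ {suc n} (suc d) (ha , hb) = Order≥-⊝ (suc d) ha , Order≥-⊝ d hb

Order≥-^ : ∀ {n} {x : 𝔸 n} → Order≥ 1 x → ∀ k → Order≥ k (x ^ k)
Order≥-^ {x = x} h zero    = Order≥-0 𝟙
Order≥-^         h (suc k) = Order≥-⊗ 1 k h (Order≥-^ h k)

const-neg : ∀ {n} p → const {n} (-q p) ≡ ⊝ const p
const-neg {zero}  p = refl
const-neg {suc n} p = cong₂ _,_ (const-neg p) (sym ε⁻¹≈ε)

⊝-^ : ∀ {n} (x : 𝔸 n) k → (⊝ x) ^ k ≡ const (sign k) ⊗ x ^ k
⊝-^ x zero    = sym (⊗-identityˡ 𝟙)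
⊝-^ x (suc k) = begin
  ⊝ x ⊗ (⊝ x) ^ k                  ≡⟨ cong (⊝ x ⊗_) (⊝-^ x k) ⟩
  ⊝ x ⊗ (const (sign k) ⊗ x ^ k)   ≡⟨ sym (-‿distribˡ-* x _) ⟩
  ⊝ (x ⊗ (const (sign k) ⊗ x ^ k)) ≡⟨ cong ⊝_ (⊗-swap x (const (sign k)) (x ^ k)) ⟩
  ⊝ (const (sign k) ⊗ x ^ suc k)   ≡⟨ -‿distribˡ-* (const (sign k)) _ ⟩
  ⊝ const (sign k) ⊗ x ^ suc k     ≡⟨ cong (_⊗ x ^ suc k) (sym (const-neg (sign k))) ⟩
  const (sign (suc k)) ⊗ x ^ suc k ∎
  where open ≡-Reasoning

geometric-sum : ∀ {n} (x : 𝔸 n) L → (𝟙 ⊕ x) ⊗ ∑ (upTo L) (λ k → (⊝ x) ^ k) ≡ 𝟙 ⊕ ⊝ ((⊝ x) ^ L)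
geometric-sum x zero    = trans (zeroʳ (𝟙 ⊕ x)) (sym (⊕-inverseʳ 𝟙))
geometric-sum x (suc L) = begin
  (𝟙 ⊕ x) ⊗ ∑ (upTo (suc L)) y^     ≡⟨ cong ((𝟙 ⊕ x) ⊗_) (∑-applyUpTo-suc id L y^) ⟩
  (𝟙 ⊕ x) ⊗ (S ⊕ w)                ≡⟨ ⊗-distribˡ (𝟙 ⊕ x) S w ⟩
  (𝟙 ⊕ x) ⊗ S ⊕ (𝟙 ⊕ x) ⊗ w        ≡⟨ cong₂ _⊕_ (geometric-sum x L) (⊗-distribʳ w 𝟙 x) ⟩
  (𝟙 ⊕ ⊝ w) ⊕ (𝟙 ⊗ w ⊕ x ⊗ w)      ≡⟨ cong (λ t → (𝟙 ⊕ ⊝ w) ⊕ (t ⊕ x ⊗ w)) (⊗-identityˡ w) ⟩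
  (𝟙 ⊕ ⊝ w) ⊕ (w ⊕ x ⊗ w)          ≡⟨ ⊕-assoc 𝟙 (⊝ w) _ ⟩
  𝟙 ⊕ (⊝ w ⊕ (w ⊕ x ⊗ w))          ≡⟨ cong (𝟙 ⊕_) (sym (⊕-assoc (⊝ w) w (x ⊗ w))) ⟩
  𝟙 ⊕ ((⊝ w ⊕ w) ⊕ x ⊗ w)          ≡⟨ cong (λ t → 𝟙 ⊕ (t ⊕ x ⊗ w)) (⊕-inverseˡ w) ⟩
  𝟙 ⊕ (𝟘 ⊕ x ⊗ w)                  ≡⟨ cong (𝟙 ⊕_) (⊕-identityˡ (x ⊗ w)) ⟩
  𝟙 ⊕ x ⊗ w                        ≡⟨ cong (𝟙 ⊕_) (sym (⁻¹-involutive (x ⊗ w))) ⟩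
  𝟙 ⊕ ⊝ ⊝ (x ⊗ w)                  ≡⟨ cong (λ t → 𝟙 ⊕ ⊝ t) (-‿distribˡ-* x w) ⟩
  𝟙 ⊕ ⊝ (⊝ x ⊗ w)                  ∎
  where
  open ≡-Reasoning
  y^ = λ k → (⊝ x) ^ k
  S = ∑ (upTo L) y^
  w = (⊝ x) ^ L

𝟙⊕-inverse : ∀ {n} (x : 𝔸 n) → Order≥ 1 x → (𝟙 ⊕ x) ⊗ ∑ (upTo (suc n)) (λ k → (⊝ x) ^ k) ≡ 𝟙
𝟙⊕-inverse {n} x h = begin
  (𝟙 ⊕ x) ⊗ ∑ (upTo (suc n)) (λ k → (⊝ x) ^ k)  ≡⟨ geometric-sum x (suc n) ⟩
  𝟙 ⊕ ⊝ ((⊝ x) ^ suc n)                         ≡⟨ cong (λ t → 𝟙 ⊕ ⊝ t) (Order≥⇒≡𝟘 (suc n) ℕₚ.≤-refl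
                                                     (Order≥-^ (Order≥-⊝ 1 h) (suc n))) ⟩
  𝟙 ⊕ ⊝ 𝟘                                       ≡⟨ cong (𝟙 ⊕_) ε⁻¹≈ε ⟩
  𝟙 ⊕ 𝟘                                         ≡⟨ ⊕-identityʳ 𝟙 ⟩
  𝟙                                             ∎
  where open ≡-Reasoning

-- Counting ordered decompositions by coefficients of products

covers : ∀ {n k} → Vec (Maybe (Fin k)) n → Subset n → Bool
covers g J = Vec.foldr (λ _ → Bool) _∧_ true (Vec.zipWith (λ m s → if isNothing m then not s else s) g J)

proj₁-∏ᶠ : ∀ {n} k (f : Fin k → 𝔸 (suc n)) → proj₁ (∏ᶠ k f) ≡ ∏ᶠ k (proj₁ ∘ f)
proj₁-∏ᶠ zero    f = refl
proj₁-∏ᶠ (suc k) f = cong (proj₁ (f Fin.zero) ⊗_) (proj₁-∏ᶠ k (f ∘ Fin.suc))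

-- The t-th term of the Leibniz rule for the x₀-part of a product.
leibnizTerm : ∀ {n k} → Fin k → (Fin k → 𝔸 (suc n)) → Fin k → 𝔸 n
leibnizTerm t f i = if ⌊ i ≟ t ⌋ then proj₂ (f i) else proj₁ (f i)

leibnizTerm-suc : ∀ {n k} (t : Fin k) (f : Fin (suc k) → 𝔸 (suc n)) i →
                  leibnizTerm (Fin.suc t) f (Fin.suc i) ≡ leibnizTerm t (f ∘ Fin.suc) i
leibnizTerm-suc t f i with i ≟ t
... | yes _ = refl
... | no  _ = refl

proj₂-∏ᶠ : ∀ {n} k (f : Fin k → 𝔸 (suc n)) → proj₂ (∏ᶠ k f) ≡ ∑ᶠ k (λ t → ∏ᶠ k (leibnizTerm t f))
proj₂-∏ᶠ zero    f = refl
proj₂-∏ᶠ (suc k) f = begin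
  a ⊗ proj₂ R ⊕ b ⊗ proj₁ R
    ≡⟨ ⊕-comm _ _ ⟩
  b ⊗ proj₁ R ⊕ a ⊗ proj₂ R
    ≡⟨ cong₂ (λ u v → b ⊗ u ⊕ a ⊗ v) (proj₁-∏ᶠ k (f ∘ Fin.suc)) (proj₂-∏ᶠ k (f ∘ Fin.suc)) ⟩
  b ⊗ ∏ᶠ k (proj₁ ∘ f ∘ Fin.suc) ⊕ a ⊗ ∑ᶠ k (λ t → ∏ᶠ k (leibnizTerm t (f ∘ Fin.suc)))
    ≡⟨ cong (b ⊗ ∏ᶠ k (proj₁ ∘ f ∘ Fin.suc) ⊕_) (sym (∑ᶠ-⊗ˡ k a _)) ⟩
  b ⊗ ∏ᶠ k (proj₁ ∘ f ∘ Fin.suc) ⊕ ∑ᶠ k (λ t → a ⊗ ∏ᶠ k (leibnizTerm t (f ∘ Fin.suc)))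
    ≡⟨ cong (b ⊗ ∏ᶠ k (proj₁ ∘ f ∘ Fin.suc) ⊕_)
         (∑ᶠ-cong k (λ t → cong (a ⊗_) (∏ᶠ-cong k (λ i → sym (leibnizTerm-suc t f i))))) ⟩
  ∑ᶠ (suc k) (λ t → ∏ᶠ (suc k) (leibnizTerm t f))  ∎
  where
  open ≡-Reasoning
  a = proj₁ (f Fin.zero)
  b = proj₂ (f Fin.zero)
  R = ∏ᶠ k (f ∘ Fin.suc)

∑-allAssignments-suc : ∀ {n k} (F : Vec (Maybe (Fin k)) (suc n) → ℚ) →
  ∑ℚ (allAssignments (suc n) k) F ≡ ∑ℚ (allAssignments n k) (λ v → F (nothing ∷ v) +q ∑ℚ (allFin k) (λ t → F (just t ∷ v)))
∑-allAssignments-suc {n} {k} F = trans (∑-concatMap _ (allAssignments n k) F) (∑-cong (allAssignments n k) (λ v →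
  trans (∑-map _ (nothing ∷ map just (allFin k)) F) (cong (F (nothing ∷ v) +q_) (∑-map just (allFin k) (λ x → F (x ∷ v))))))

at-∏ᶠ : ∀ n k (J : Subset n) (G : Fin k → 𝔸 n) →
        ∏ᶠ k G at J ≡ ∑ℚ (allAssignments n k) (λ g → 𝟙ᵇ (covers g J) *q ∏ᶠ {0} k (λ i → G i at block g i))
at-∏ᶠ zero    k []          G = sym (trans (ℚₚ.+-identityʳ _) (ℚₚ.*-identityˡ _))
at-∏ᶠ (suc n) k (false ∷ J) G = begin
  ∏ᶠ k G at (false ∷ J)
    ≡⟨ cong (_at J) (proj₁-∏ᶠ k G) ⟩
  ∏ᶠ k (proj₁ ∘ G) at J
    ≡⟨ at-∏ᶠ n k J (proj₁ ∘ G) ⟩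
  ∑ℚ (allAssignments n k) (λ v → term (nothing ∷ v))
    ≡⟨ ∑-cong (allAssignments n k) (λ v → sym (trans (cong (term (nothing ∷ v) +q_)
         (∑-𝟘 (allFin k) (λ t → ℚₚ.*-zeroˡ (∏ᶠ {0} k (λ i → G i at block (just t ∷ v) i)))))
         (ℚₚ.+-identityʳ _))) ⟩
  ∑ℚ (allAssignments n k) (λ v → term (nothing ∷ v) +q ∑ℚ (allFin k) (λ t → term (just t ∷ v)))
    ≡⟨ sym (∑-allAssignments-suc term) ⟩
  ∑ℚ (allAssignments (suc n) k) term  ∎
  where
  open ≡-Reasoning
  term = λ g → 𝟙ᵇ (covers g (false ∷ J)) *q ∏ᶠ {0} k (λ i → G i at block g i)
at-∏ᶠ (suc n) k (true ∷ J)  G = begin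
  ∏ᶠ k G at (true ∷ J)
    ≡⟨ cong (_at J) (proj₂-∏ᶠ k G) ⟩
  ∑ᶠ k (λ t → ∏ᶠ k (leibnizTerm t G)) at J
    ≡⟨ at-∑ᶠ k _ J ⟩
  ∑ᶠ {0} k (λ t → ∏ᶠ k (leibnizTerm t G) at J)
    ≡⟨ ∑ᶠ-cong k (λ t → at-∏ᶠ n k J (leibnizTerm t G)) ⟩
  ∑ᶠ {0} k (λ t → ∑ℚ (allAssignments n k) (λ v → 𝟙ᵇ (covers v J) *q ∏ᶠ {0} k (λ i → leibnizTerm t G i at block v i)))
    ≡⟨ ∑ᶠ-∑ k (allAssignments n k) _ ⟩
  ∑ℚ (allAssignments n k) (λ v → ∑ᶠ {0} k (λ t → 𝟙ᵇ (covers v J) *q ∏ᶠ {0} k (λ i → leibnizTerm t G i at block v i)))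
    ≡⟨ ∑-cong (allAssignments n k) (λ v → ∑ᶠ-cong k (λ t →
         cong (𝟙ᵇ (covers v J) *q_) (∏ᶠ-cong k (λ i → at-leibnizTerm t i v)))) ⟩
  ∑ℚ (allAssignments n k) (λ v → ∑ᶠ {0} k (λ t → term (just t ∷ v)))
    ≡⟨ ∑-cong (allAssignments n k) (λ v → sym (trans
         (cong₂ _+q_ (ℚₚ.*-zeroˡ (∏ᶠ {0} k (λ i → G i at block (nothing ∷ v) i)))
                     (∑-tabulate k id (λ t → term (just t ∷ v))))
         (ℚₚ.+-identityˡ _))) ⟩
  ∑ℚ (allAssignments n k) (λ v → term (nothing ∷ v) +q ∑ℚ (allFin k) (λ t → term (just t ∷ v)))
    ≡⟨ sym (∑-allAssignments-suc term) ⟩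
  ∑ℚ (allAssignments (suc n) k) term  ∎
  where
  open ≡-Reasoning
  term = λ g → 𝟙ᵇ (covers g (true ∷ J)) *q ∏ᶠ {0} k (λ i → G i at block g i)
  at-leibnizTerm : ∀ t i v → leibnizTerm t G i at block v i ≡ G i at block (just t ∷ v) i
  at-leibnizTerm t i v with ⌊ i ≟ t ⌋
  ... | true  = refl
  ... | false = refl

count-decompositions :
  ∀ n k (B : Subset n → Bool) (J : Subset n) (P : Fin k → Subset n → Bool) →
  ι (+ length (filterᵇ (λ g → validDecomp B J g ∧ all (λ i → P i (block g i)) (allFin k))
                       (allAssignments n k)))
  ≡ ∏ᶠ k (λ i → fromCoeffs (λ K → 𝟙ᵇ (discreteᵇ B K ∧ P i K))) at J
count-decompositions n k B J P = begin
  ι (+ length (filterᵇ valid (allAssignments n k)))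
    ≡⟨ ι-count valid (allAssignments n k) ⟩
  ∑ℚ (allAssignments n k) (𝟙ᵇ ∘ valid)
    ≡⟨ ∑-cong (allAssignments n k) 𝟙ᵇ-valid ⟩
  ∑ℚ (allAssignments n k) (λ g → 𝟙ᵇ (covers g J) *q ∏ᶠ {0} k (λ i → G i at block g i))
    ≡⟨ sym (at-∏ᶠ n k J G) ⟩
  ∏ᶠ k G at J  ∎
  where
  open ≡-Reasoning
  valid = λ g → validDecomp B J g ∧ all (λ i → P i (block g i)) (allFin k)
  G = λ i → fromCoeffs (λ K → 𝟙ᵇ (discreteᵇ B K ∧ P i K))
  𝟙ᵇ-valid : ∀ g → 𝟙ᵇ (valid g) ≡ 𝟙ᵇ (covers g J) *q ∏ᶠ {0} k (λ i → G i at block g i)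
  𝟙ᵇ-valid g = begin
    𝟙ᵇ ((c ∧ d) ∧ p)               ≡⟨ 𝟙ᵇ-∧ (c ∧ d) p ⟩
    𝟙ᵇ (c ∧ d) *q 𝟙ᵇ p             ≡⟨ cong (_*q 𝟙ᵇ p) (𝟙ᵇ-∧ c d) ⟩
    (𝟙ᵇ c *q 𝟙ᵇ d) *q 𝟙ᵇ p         ≡⟨ ℚₚ.*-assoc (𝟙ᵇ c) (𝟙ᵇ d) (𝟙ᵇ p) ⟩
    𝟙ᵇ c *q (𝟙ᵇ d *q 𝟙ᵇ p)         ≡⟨ cong (𝟙ᵇ c *q_) (cong₂ _*q_ (𝟙ᵇ-all-tabulate k id _) (𝟙ᵇ-all-tabulate k id _)) ⟩
    𝟙ᵇ c *q (∏ᶠ k D *q ∏ᶠ k Q)     ≡⟨ cong (𝟙ᵇ c *q_) (∏ᶠ-⊗ k D Q) ⟩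
    𝟙ᵇ c *q ∏ᶠ k (λ i → D i *q Q i) ≡⟨ cong (𝟙ᵇ c *q_) (∏ᶠ-cong k λ i →
                                        trans (sym (𝟙ᵇ-∧ (discreteᵇ B (block g i)) (P i (block g i))))
                                              (sym (fromCoeffs-at _ (block g i)))) ⟩
    𝟙ᵇ c *q ∏ᶠ {0} k (λ i → G i at block g i)  ∎
    where
    c = covers g J
    d = all (λ i → discreteᵇ B (block g i)) (allFin k)
    p = all (λ i → P i (block g i)) (allFin k)
    D = λ i → 𝟙ᵇ (discreteᵇ B (block g i))
    Q = λ i → 𝟙ᵇ (P i (block g i))

∏ˡ : ∀ {n} → (ℕ → 𝔸 n) → List ℕ → 𝔸 n
∏ˡ f []      = 𝟙
∏ˡ f (a ∷ α) = f a ⊗ ∏ˡ f α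

∏ᶠ-lookup : ∀ {n} (f : ℕ → 𝔸 n) α → ∏ᶠ (length α) (f ∘ lookup α) ≡ ∏ˡ f α
∏ᶠ-lookup f []      = refl
∏ᶠ-lookup f (a ∷ α) = cong (f a ⊗_) (∏ᶠ-lookup f α)

discreteSum : ∀ {n} → (Subset n → Bool) → 𝔸 n
discreteSum B = fromCoeffs (λ K → 𝟙ᵇ (discreteᵇ B K ∧ (1 ≤ᵇ ∣ K ∣)))

discreteSumOfSize : ∀ {n} → (Subset n → Bool) → ℕ → 𝔸 n
discreteSumOfSize B a = fromCoeffs (λ K → 𝟙ᵇ (discreteᵇ B K ∧ (∣ K ∣ ≡ᵇ a)))

ι-Nₖ : ∀ {n} (B : Subset n → Bool) J k → ι (+ Nₖ B J k) ≡ (discreteSum B ^ k) at J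
ι-Nₖ {n} B J k = count-decompositions n k B J (λ _ K → 1 ≤ᵇ ∣ K ∣)

ι-ζ : ∀ {n} (B : Subset n → Bool) α → ι (+ ζ B α) ≡ ∏ˡ (discreteSumOfSize B) α at ⊤
ι-ζ {n} B α = trans (count-decompositions n (length α) B ⊤ (λ i K → ∣ K ∣ ≡ᵇ lookup α i))
                    (cong (_at ⊤) (∏ᶠ-lookup (discreteSumOfSize B) α))

all-mono : {A : Set} (p q : A → Bool) (xs : List A) →
           (∀ x → p x ≡ true → q x ≡ true) → all p xs ≡ true → all q xs ≡ true
all-mono p q []       p⇒q _ = refl
all-mono p q (x ∷ xs) p⇒q all-p with p x in px
... | true = cong₂ _∧_ (p⇒q x px) (all-mono p q xs p⇒q all-p)

⊆ᵇ-trans : ∀ {n} (S L K : Subset n) → S ⊆ᵇ L ≡ true → L ⊆ᵇ K ≡ true → S ⊆ᵇ K ≡ true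
⊆ᵇ-trans []          []          []          _   _   = refl
⊆ᵇ-trans (true ∷ S)  (true ∷ L)  (true ∷ K)  S⊆L L⊆K = ⊆ᵇ-trans S L K S⊆L L⊆K
⊆ᵇ-trans (false ∷ S) (true ∷ L)  (true ∷ K)  S⊆L L⊆K = ⊆ᵇ-trans S L K S⊆L L⊆K
⊆ᵇ-trans (false ∷ S) (false ∷ L) (true ∷ K)  S⊆L L⊆K = ⊆ᵇ-trans S L K S⊆L L⊆K
⊆ᵇ-trans (false ∷ S) (false ∷ L) (false ∷ K) S⊆L L⊆K = ⊆ᵇ-trans S L K S⊆L L⊆K
⊆ᵇ-trans (true ∷ S)  (false ∷ L) K           ()  _
⊆ᵇ-trans (_ ∷ S)     (true ∷ L)  (false ∷ K) _   ()

discreteᵇ-⊆ : ∀ {n} (B : Subset n → Bool) {K L} → discreteᵇ B K ≡ true → L ⊆ᵇ K ≡ true → discreteᵇ B L ≡ true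
discreteᵇ-⊆ {n} B {K} {L} discrete-K L⊆K = all-mono _ _ (allSubsets n) step discrete-K
  where
  step : ∀ S → (not (B S ∧ (S ⊆ᵇ K)) ∨ (∣ S ∣ ≤ᵇ 1)) ≡ true → (not (B S ∧ (S ⊆ᵇ L)) ∨ (∣ S ∣ ≤ᵇ 1)) ≡ true
  step S e with B S | S ⊆ᵇ L in S⊆L
  ... | false | _     = refl
  ... | true  | false = refl
  ... | true  | true  rewrite ⊆ᵇ-trans S L K S⊆L L⊆K = e

zetaInv-∅ : ∀ {n} (B : Subset n → Bool) K → ∣ K ∣ ≡ 0 → zetaInv B K ≡ + 1
zetaInv-∅ B K ∣K∣≡0 with ∣ K ∣
zetaInv-∅ B K refl | .0 = refl

zetaInv-suc : ∀ {n} (B : Subset n → Bool) K m → ∣ K ∣ ≡ suc m →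
  zetaInv B K ≡ sumℤ (map (λ k → ((ℤ.- + 1) ℤ.^ k) ℤ.* (+ Nₖ B K k)) (applyUpTo suc (suc m)))
zetaInv-suc B K m ∣K∣≡1+m with ∣ K ∣
zetaInv-suc B K m refl | .(suc m) = refl

-- The series of discrete sets of an eulerian building set

module DiscreteSeries {n : ℕ} (B : Subset n → Bool) where

  Z : 𝔸 n
  Z = discreteSum B

  Zₐ : ℕ → 𝔸 n
  Zₐ = discreteSumOfSize B

  at-Z : ∀ K → Z at K ≡ 𝟙ᵇ (discreteᵇ B K ∧ (1 ≤ᵇ ∣ K ∣))
  at-Z = fromCoeffs-at _

  at-Z-∅ : ∀ K → ∣ K ∣ ≡ 0 → 𝟙ᵇ (discreteᵇ B K ∧ (1 ≤ᵇ ∣ K ∣)) ≡ 0ℚ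
  at-Z-∅ K ∣K∣≡0 =
    trans (cong (λ m → 𝟙ᵇ (discreteᵇ B K ∧ (1 ≤ᵇ m))) ∣K∣≡0) (cong 𝟙ᵇ (∧-zeroʳ (discreteᵇ B K)))

  Order≥-Z : Order≥ 1 Z
  Order≥-Z = Order≥-fromCoeffs 1 _ (λ K ∣K∣<1 → at-Z-∅ K (ℕₚ.n<1⇒n≡0 ∣K∣<1))

  c₀-Z : c₀ Z ≡ 0ℚ
  c₀-Z = trans (c₀-at Z) (trans (at-Z ∅) (at-Z-∅ ∅ (∣⊥∣≡0 n)))

  Z⁻ : 𝔸 n
  Z⁻ = ∑ (upTo (suc n)) (λ k → (⊝ Z) ^ k)

  𝟙⊕Z⊗Z⁻ : (𝟙 ⊕ Z) ⊗ Z⁻ ≡ 𝟙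
  𝟙⊕Z⊗Z⁻ = 𝟙⊕-inverse Z Order≥-Z

  ι-zetaInv : ∀ K m → ∣ K ∣ ≡ suc m → ι (zetaInv B K) ≡ Z⁻ at K
  ι-zetaInv K m ∣K∣≡1+m = begin
    ι (zetaInv B K)
      ≡⟨ cong ι (zetaInv-suc B K m ∣K∣≡1+m) ⟩
    ι (sumℤ (map (λ k → ((ℤ.- + 1) ℤ.^ k) ℤ.* (+ Nₖ B K k)) (applyUpTo suc (suc m))))
      ≡⟨ ι-sumℤ (λ k → ((ℤ.- + 1) ℤ.^ k) ℤ.* (+ Nₖ B K k)) (applyUpTo suc (suc m)) ⟩
    ∑ℚ (applyUpTo suc (suc m)) (λ k → ι (((ℤ.- + 1) ℤ.^ k) ℤ.* (+ Nₖ B K k)))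
      ≡⟨ ∑-cong (applyUpTo suc (suc m)) (λ k →
           trans (ι-* ((ℤ.- + 1) ℤ.^ k) (+ Nₖ B K k)) (cong₂ _*q_ (ι-sign k) (ι-Nₖ B K k))) ⟩
    ∑ℚ (applyUpTo suc (suc m)) term
      ≡⟨ sym (ℚₚ.+-identityˡ _) ⟩
    0ℚ +q ∑ℚ (applyUpTo suc (suc m)) term
      ≡⟨ cong (_+q ∑ℚ (applyUpTo suc (suc m)) term) (sym term-0) ⟩
    ∑ℚ (upTo (suc (suc m))) term
      ≡⟨ sym (∑-upTo-truncate term (suc n) (s≤s (subst (_≤ n) ∣K∣≡1+m (∣p∣≤n K))) term-big) ⟩
    ∑ℚ (upTo (suc n)) term
      ≡⟨ sym (∑-cong (upTo (suc n)) (λ k → at-const⊗ (sign k) (Z ^ k) K)) ⟩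
    ∑ℚ (upTo (suc n)) (λ k → (const (sign k) ⊗ Z ^ k) at K)
      ≡⟨ sym (at-∑ (upTo (suc n)) _ K) ⟩
    ∑ (upTo (suc n)) (λ k → const (sign k) ⊗ Z ^ k) at K
      ≡⟨ cong (_at K) (∑-cong (upTo (suc n)) (λ k → sym (⊝-^ Z k))) ⟩
    Z⁻ at K  ∎
    where
    open ≡-Reasoning
    term = λ k → sign k *q (Z ^ k) at K
    term-0 : term 0 ≡ 0ℚ
    term-0 = begin
      1ℚ *q 𝟙 at K                               ≡⟨ cong (1ℚ *q_) (at-𝟙 K) ⟩
      1ℚ *q (if ∣ K ∣ ≡ᵇ 0 then 1ℚ else 0ℚ)      ≡⟨ cong (λ m → 1ℚ *q (if m ≡ᵇ 0 then 1ℚ else 0ℚ)) ∣K∣≡1+m ⟩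
      1ℚ *q 0ℚ                                   ≡⟨ ℚₚ.*-zeroʳ 1ℚ ⟩
      0ℚ                                         ∎
    term-big : ∀ k → suc (suc m) ≤ k → term k ≡ 0ℚ
    term-big k 2+m≤k = trans (cong (sign k *q_) (Order≥⇒at≡0 k K (Order≥-^ Order≥-Z k)
                         (subst (_< k) (sym ∣K∣≡1+m) 2+m≤k))) (ℚₚ.*-zeroʳ (sign k))

  at-𝟙⊕σZ : ∀ K → (𝟙 ⊕ σ Z) at K ≡
            (if ∣ K ∣ ≡ᵇ 0 then 1ℚ else 0ℚ) +q sign ∣ K ∣ *q 𝟙ᵇ (discreteᵇ B K ∧ (1 ≤ᵇ ∣ K ∣))
  at-𝟙⊕σZ K = trans (at-⊕ 𝟙 (σ Z) K) (cong₂ _+q_ (at-𝟙 K) (trans (at-σ Z K) (cong (sign ∣ K ∣ *q_) (at-Z K))))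

  at-𝟙⊕σZ-discrete : ∀ K → discreteᵇ B K ≡ true → (𝟙 ⊕ σ Z) at K ≡ sign ∣ K ∣
  at-𝟙⊕σZ-discrete K discrete-K = trans (at-𝟙⊕σZ K)
    (trans (cong (λ d → (if ∣ K ∣ ≡ᵇ 0 then 1ℚ else 0ℚ) +q sign ∣ K ∣ *q 𝟙ᵇ (d ∧ (1 ≤ᵇ ∣ K ∣))) discrete-K)
           (by-size ∣ K ∣))
    where
    by-size : ∀ c → (if c ≡ᵇ 0 then 1ℚ else 0ℚ) +q sign c *q 𝟙ᵇ (1 ≤ᵇ c) ≡ sign c
    by-size zero    = refl
    by-size (suc c) = trans (ℚₚ.+-identityˡ _) (ℚₚ.*-identityʳ (sign (suc c)))

  at-𝟙⊕σZ-nondiscrete : ∀ K m → ∣ K ∣ ≡ suc m → discreteᵇ B K ≡ false → (𝟙 ⊕ σ Z) at K ≡ 0ℚ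
  at-𝟙⊕σZ-nondiscrete K m ∣K∣≡1+m nondiscrete-K = trans (at-𝟙⊕σZ K)
    (trans (cong₂ (λ c d → (if c ≡ᵇ 0 then 1ℚ else 0ℚ) +q sign c *q 𝟙ᵇ (d ∧ (1 ≤ᵇ c))) ∣K∣≡1+m nondiscrete-K)
           (trans (ℚₚ.+-identityˡ _) (ℚₚ.*-zeroʳ (sign (suc m)))))

  at-𝟙⊕Z-discrete : ∀ L → discreteᵇ B L ≡ true → (𝟙 ⊕ Z) at L ≡ 1ℚ
  at-𝟙⊕Z-discrete L discrete-L = trans (at-⊕ 𝟙 Z L)
    (trans (cong₂ _+q_ (at-𝟙 L) (trans (at-Z L) (cong (λ d → 𝟙ᵇ (d ∧ (1 ≤ᵇ ∣ L ∣))) discrete-L)))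
           (by-size ∣ L ∣))
    where
    by-size : ∀ c → (if c ≡ᵇ 0 then 1ℚ else 0ℚ) +q 𝟙ᵇ (1 ≤ᵇ c) ≡ 1ℚ
    by-size zero    = refl
    by-size (suc c) = refl

  restrict-cong : ∀ K {x y : 𝔸 n} → (∀ L → L ⊆ᵇ K ≡ true → x at L ≡ y at L) → restrict K x ≡ restrict K y
  restrict-cong K {x} {y} h = coeff-ext λ L → trans (at-restrict K x L) (trans (on-⊆ L) (sym (at-restrict K y L)))
    where
    on-⊆ : ∀ L → (if L ⊆ᵇ K then x at L else 0ℚ) ≡ (if L ⊆ᵇ K then y at L else 0ℚ)
    on-⊆ L with L ⊆ᵇ K in L⊆K
    ... | true  = h L L⊆K
    ... | false = refl

  -- On a discrete K, both Z⁻ and 1 + σ Z restrict to the inverse of the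
  -- restriction of 1 + Z, which is that of the all-ones series.
  at-Z⁻-discrete : ∀ K → discreteᵇ B K ≡ true → Z⁻ at K ≡ (𝟙 ⊕ σ Z) at K
  at-Z⁻-discrete K discrete-K = begin
    Z⁻ at K                        ≡⟨ sym (at-restrict-self K Z⁻) ⟩
    restrict K Z⁻ at K             ≡⟨ cong (_at K) (⊗-inverse-unique (restrict K all-ones) _ _
                                        (inverse-of-all-ones Z⁻ 𝟙⊕Z⊗Z⁻) σall-ones-inverse) ⟩
    restrict K (σ all-ones) at K   ≡⟨ at-restrict-self K (σ all-ones) ⟩
    σ all-ones at K                ≡⟨ at-σ all-ones K ⟩
    sign ∣ K ∣ *q all-ones at K    ≡⟨ cong (sign ∣ K ∣ *q_) (at-all-ones K) ⟩
    sign ∣ K ∣ *q 1ℚ               ≡⟨ ℚₚ.*-identityʳ (sign ∣ K ∣) ⟩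
    sign ∣ K ∣                     ≡⟨ sym (at-𝟙⊕σZ-discrete K discrete-K) ⟩
    (𝟙 ⊕ σ Z) at K                 ∎
    where
    open ≡-Reasoning
    restrict-𝟙⊕Z : restrict K (𝟙 ⊕ Z) ≡ restrict K all-ones
    restrict-𝟙⊕Z = restrict-cong K λ L L⊆K →
      trans (at-𝟙⊕Z-discrete L (discreteᵇ-⊆ B discrete-K L⊆K)) (sym (at-all-ones L))
    inverse-of-all-ones : ∀ y → (𝟙 ⊕ Z) ⊗ y ≡ 𝟙 → restrict K all-ones ⊗ restrict K y ≡ 𝟙
    inverse-of-all-ones y [𝟙⊕Z]y≡𝟙 = begin
      restrict K all-ones ⊗ restrict K y    ≡⟨ cong (_⊗ restrict K y) (sym restrict-𝟙⊕Z) ⟩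
      restrict K (𝟙 ⊕ Z) ⊗ restrict K y     ≡⟨ sym (restrict-⊗ K (𝟙 ⊕ Z) y) ⟩
      restrict K ((𝟙 ⊕ Z) ⊗ y)              ≡⟨ cong (restrict K) [𝟙⊕Z]y≡𝟙 ⟩
      restrict K 𝟙                          ≡⟨ restrict-𝟙 K ⟩
      𝟙                                     ∎
    σall-ones-inverse : restrict K all-ones ⊗ restrict K (σ all-ones) ≡ 𝟙
    σall-ones-inverse = trans (sym (restrict-⊗ K _ _)) (trans (cong (restrict K) all-ones⊗σall-ones) (restrict-𝟙 K))

  Homogeneous-Zₐ : ∀ r → Homogeneous r (Zₐ r)
  Homogeneous-Zₐ r = Homogeneous-fromCoeffs r _ off-degree
    where
    off-degree : ∀ K → ¬ ∣ K ∣ ≡ r → 𝟙ᵇ (discreteᵇ B K ∧ (∣ K ∣ ≡ᵇ r)) ≡ 0ℚ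
    off-degree K ∣K∣≢r with ∣ K ∣ ≡ᵇ r in ∣K∣≡ᵇr
    ... | true  = ⊥-elim (∣K∣≢r (ℕₚ.≡ᵇ⇒≡ ∣ K ∣ r (subst T (sym ∣K∣≡ᵇr) tt)))
    ... | false = cong 𝟙ᵇ (∧-zeroʳ (discreteᵇ B K))

  ∑-Zₐ : ∑ (applyUpTo suc n) Zₐ ≡ Z
  ∑-Zₐ = coeff-ext λ K → begin
    ∑ (applyUpTo suc n) Zₐ at K
      ≡⟨ at-∑ (applyUpTo suc n) Zₐ K ⟩
    ∑ℚ (applyUpTo suc n) (λ r → Zₐ r at K)
      ≡⟨ ∑-cong (applyUpTo suc n) (λ r → trans (fromCoeffs-at _ K) (𝟙ᵇ-∧ (discreteᵇ B K) (∣ K ∣ ≡ᵇ r))) ⟩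
    ∑ℚ (applyUpTo suc n) (λ r → 𝟙ᵇ (discreteᵇ B K) *q 𝟙ᵇ (∣ K ∣ ≡ᵇ r))
      ≡⟨ ∑-⊗ˡ (applyUpTo suc n) (𝟙ᵇ (discreteᵇ B K)) _ ⟩
    𝟙ᵇ (discreteᵇ B K) *q ∑ℚ (applyUpTo suc n) (λ r → 𝟙ᵇ (∣ K ∣ ≡ᵇ r))
      ≡⟨ cong (𝟙ᵇ (discreteᵇ B K) *q_) (∑ℚ-𝟙ᵇ-≡ᵇ ∣ K ∣ n (∣p∣≤n K)) ⟩
    𝟙ᵇ (discreteᵇ B K) *q 𝟙ᵇ (1 ≤ᵇ ∣ K ∣)
      ≡⟨ sym (trans (at-Z K) (𝟙ᵇ-∧ (discreteᵇ B K) (1 ≤ᵇ ∣ K ∣))) ⟩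
    Z at K  ∎
    where open ≡-Reasoning

  -- The series of a run 𝐞ʲ of a ce-word entered with a current part of size r.
  h : ℕ → ℕ → 𝔸 n
  h r zero    = Zₐ r
  h r (suc j) = h (suc r) j ⊕ const (-q ½) ⊗ (Zₐ r ⊗ h 1 j)

  Homogeneous-h : ∀ r j → Homogeneous (r + j) (h r j)
  Homogeneous-h r zero    = subst (λ d → Homogeneous d (Zₐ r)) (sym (ℕₚ.+-identityʳ r)) (Homogeneous-Zₐ r)
  Homogeneous-h r (suc j) = Homogeneous-⊕ (r + suc j)
    (subst (λ d → Homogeneous d (h (suc r) j)) (sym (ℕₚ.+-suc r j)) (Homogeneous-h (suc r) j))
    (Homogeneous-⊗ 0 (r + suc j) (Homogeneous-const (-q ½))
      (Homogeneous-⊗ r (suc j) (Homogeneous-Zₐ r) (Homogeneous-h 1 j)))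

  h≡𝟘 : ∀ r j → n < r + j → h r j ≡ 𝟘
  h≡𝟘 r j n<r+j = Homogeneous⇒≡𝟘 (r + j) n<r+j (Homogeneous-h r j)

  hSum : ℕ → 𝔸 n
  hSum r = ∑ (upTo (suc n)) (h r)

  g : 𝔸 n
  g = hSum 1

  ∑-upTo-h : ∀ r → ∑ (upTo n) (h (suc r)) ≡ hSum (suc r)
  ∑-upTo-h r = sym (∑-upTo-truncate (h (suc r)) (suc n) (ℕₚ.n≤1+n n)
    (λ j n≤j → h≡𝟘 (suc r) j (s≤s (ℕₚ.≤-trans n≤j (ℕₚ.m≤n+m j r)))))

  hSum-step : ∀ r → hSum r ≡ (Zₐ r ⊕ const (-q ½) ⊗ (Zₐ r ⊗ g)) ⊕ hSum (suc r)
  hSum-step r = begin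
    Zₐ r ⊕ ∑ (applyUpTo suc n) (h r)
      ≡⟨ cong (Zₐ r ⊕_) (∑-applyUpTo suc n (h r)) ⟩
    Zₐ r ⊕ ∑ (upTo n) (λ j → h (suc r) j ⊕ c ⊗ (Zₐ r ⊗ h 1 j))
      ≡⟨ cong (Zₐ r ⊕_) (∑-⊕ (upTo n) (h (suc r)) _) ⟩
    Zₐ r ⊕ (∑ (upTo n) (h (suc r)) ⊕ ∑ (upTo n) (λ j → c ⊗ (Zₐ r ⊗ h 1 j)))
      ≡⟨ cong (λ t → Zₐ r ⊕ (∑ (upTo n) (h (suc r)) ⊕ t))
           (trans (∑-⊗ˡ (upTo n) c _) (cong (c ⊗_) (∑-⊗ˡ (upTo n) (Zₐ r) (h 1)))) ⟩
    Zₐ r ⊕ (∑ (upTo n) (h (suc r)) ⊕ c ⊗ (Zₐ r ⊗ ∑ (upTo n) (h 1)))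
      ≡⟨ cong₂ (λ u v → Zₐ r ⊕ (u ⊕ c ⊗ (Zₐ r ⊗ v))) (∑-upTo-h r) (∑-upTo-h 0) ⟩
    Zₐ r ⊕ (hSum (suc r) ⊕ c ⊗ (Zₐ r ⊗ g))
      ≡⟨ cong (Zₐ r ⊕_) (⊕-comm _ _) ⟩
    Zₐ r ⊕ (c ⊗ (Zₐ r ⊗ g) ⊕ hSum (suc r))
      ≡⟨ sym (⊕-assoc _ _ _) ⟩
    (Zₐ r ⊕ c ⊗ (Zₐ r ⊗ g)) ⊕ hSum (suc r)  ∎
    where
    open ≡-Reasoning
    c = const (-q ½)

  g-fixpoint : g ≡ Z ⊕ const (-q ½) ⊗ (Z ⊗ g)
  g-fixpoint = begin
    g
      ≡⟨ ∑-telescope hSum _ hSum-step n ⟩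
    ∑ (applyUpTo suc n) (λ r → Zₐ r ⊕ c ⊗ (Zₐ r ⊗ g)) ⊕ hSum (suc n)
      ≡⟨ cong (∑ (applyUpTo suc n) (λ r → Zₐ r ⊕ c ⊗ (Zₐ r ⊗ g)) ⊕_)
           (∑-𝟘 (upTo (suc n)) (λ j → h≡𝟘 (suc n) j (s≤s (ℕₚ.m≤m+n n j)))) ⟩
    ∑ (applyUpTo suc n) (λ r → Zₐ r ⊕ c ⊗ (Zₐ r ⊗ g)) ⊕ 𝟘
      ≡⟨ ⊕-identityʳ _ ⟩
    ∑ (applyUpTo suc n) (λ r → Zₐ r ⊕ c ⊗ (Zₐ r ⊗ g))
      ≡⟨ ∑-⊕ (applyUpTo suc n) Zₐ _ ⟩
    ∑ (applyUpTo suc n) Zₐ ⊕ ∑ (applyUpTo suc n) (λ r → c ⊗ (Zₐ r ⊗ g))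
      ≡⟨ cong (∑ (applyUpTo suc n) Zₐ ⊕_)
           (trans (∑-⊗ˡ (applyUpTo suc n) c _) (cong (c ⊗_) (∑-⊗ʳ (applyUpTo suc n) g Zₐ))) ⟩
    ∑ (applyUpTo suc n) Zₐ ⊕ c ⊗ (∑ (applyUpTo suc n) Zₐ ⊗ g)
      ≡⟨ cong (λ t → t ⊕ c ⊗ (t ⊗ g)) ∑-Zₐ ⟩
    Z ⊕ c ⊗ (Z ⊗ g)  ∎
    where
    open ≡-Reasoning
    c = const (-q ½)

  g-equation : (𝟙 ⊕ const ½ ⊗ Z) ⊗ g ≡ Z
  g-equation = begin
    (𝟙 ⊕ const ½ ⊗ Z) ⊗ g                         ≡⟨ ⊗-distribʳ g 𝟙 (const ½ ⊗ Z) ⟩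
    𝟙 ⊗ g ⊕ (const ½ ⊗ Z) ⊗ g                     ≡⟨ cong₂ _⊕_ (⊗-identityˡ g) (⊗-assoc (const ½) Z g) ⟩
    g ⊕ const ½ ⊗ (Z ⊗ g)                         ≡⟨ cong (_⊕ const ½ ⊗ (Z ⊗ g)) g-fixpoint ⟩
    (Z ⊕ const (-q ½) ⊗ (Z ⊗ g)) ⊕ const ½ ⊗ (Z ⊗ g) ≡⟨ ⊕-assoc Z _ _ ⟩
    Z ⊕ (const (-q ½) ⊗ (Z ⊗ g) ⊕ const ½ ⊗ (Z ⊗ g)) ≡⟨ cong (Z ⊕_) (sym (⊗-distribʳ (Z ⊗ g) _ _)) ⟩
    Z ⊕ (const (-q ½) ⊕ const ½) ⊗ (Z ⊗ g)         ≡⟨ cong (λ t → Z ⊕ t ⊗ (Z ⊗ g)) (sym (const-+ (-q ½) ½)) ⟩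
    Z ⊕ const (-q ½ +q ½) ⊗ (Z ⊗ g)               ≡⟨ cong (λ t → Z ⊕ t ⊗ (Z ⊗ g)) const-0 ⟩
    Z ⊕ 𝟘 ⊗ (Z ⊗ g)                               ≡⟨ cong (Z ⊕_) (⊗-zeroˡ (Z ⊗ g)) ⟩
    Z ⊕ 𝟘                                         ≡⟨ ⊕-identityʳ Z ⟩
    Z                                             ∎
    where open ≡-Reasoning

  module _ (eulerian : Eulerian B) where

    Z⁻≡𝟙⊕σZ : Z⁻ ≡ 𝟙 ⊕ σ Z
    Z⁻≡𝟙⊕σZ = coeff-ext λ K → by-discreteness K (discreteᵇ B K) refl
      where
      by-discreteness : ∀ K d → discreteᵇ B K ≡ d → Z⁻ at K ≡ (𝟙 ⊕ σ Z) at K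
      by-discreteness K true  discrete-K    = at-Z⁻-discrete K discrete-K
      by-discreteness K false nondiscrete-K with eulerian K
      ... | inj₁ discrete-K = case (trans (sym nondiscrete-K) discrete-K) of λ ()
      ... | inj₂ ζ⁻¹≡0      = by-size ∣ K ∣ refl
        where
        by-size : ∀ c → ∣ K ∣ ≡ c → Z⁻ at K ≡ (𝟙 ⊕ σ Z) at K
        by-size zero    ∣K∣≡0   = case trans (sym (zetaInv-∅ B K ∣K∣≡0)) ζ⁻¹≡0 of λ ()
        by-size (suc m) ∣K∣≡1+m = begin
          Z⁻ at K          ≡⟨ sym (ι-zetaInv K m ∣K∣≡1+m) ⟩
          ι (zetaInv B K)  ≡⟨ cong ι ζ⁻¹≡0 ⟩
          0ℚ               ≡⟨ sym (at-𝟙⊕σZ-nondiscrete K m ∣K∣≡1+m nondiscrete-K) ⟩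
          (𝟙 ⊕ σ Z) at K   ∎
          where open ≡-Reasoning

    𝟙⊕Z⊗𝟙⊕σZ : (𝟙 ⊕ Z) ⊗ (𝟙 ⊕ σ Z) ≡ 𝟙
    𝟙⊕Z⊗𝟙⊕σZ = subst (λ y → (𝟙 ⊕ Z) ⊗ y ≡ 𝟙) Z⁻≡𝟙⊕σZ 𝟙⊕Z⊗Z⁻

    𝟙⊕Z⊗σZ : (𝟙 ⊕ Z) ⊗ σ Z ≡ ⊝ Z
    𝟙⊕Z⊗σZ = inverseʳ-unique Z ((𝟙 ⊕ Z) ⊗ σ Z) (begin
      Z ⊕ u ⊗ σ Z                   ≡⟨ sym (⊕-identityˡ _) ⟩
      𝟘 ⊕ (Z ⊕ u ⊗ σ Z)             ≡⟨ cong (_⊕ (Z ⊕ u ⊗ σ Z)) (sym (⊕-inverseˡ 𝟙)) ⟩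
      (⊝ 𝟙 ⊕ 𝟙) ⊕ (Z ⊕ u ⊗ σ Z)     ≡⟨ ⊕-assoc (⊝ 𝟙) 𝟙 _ ⟩
      ⊝ 𝟙 ⊕ (𝟙 ⊕ (Z ⊕ u ⊗ σ Z))     ≡⟨ cong (⊝ 𝟙 ⊕_) (sym (⊕-assoc 𝟙 Z (u ⊗ σ Z))) ⟩
      ⊝ 𝟙 ⊕ (u ⊕ u ⊗ σ Z)           ≡⟨ cong (λ t → ⊝ 𝟙 ⊕ (t ⊕ u ⊗ σ Z)) (sym (⊗-identityʳ u)) ⟩
      ⊝ 𝟙 ⊕ (u ⊗ 𝟙 ⊕ u ⊗ σ Z)       ≡⟨ cong (⊝ 𝟙 ⊕_) (sym (⊗-distribˡ u 𝟙 (σ Z))) ⟩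
      ⊝ 𝟙 ⊕ u ⊗ (𝟙 ⊕ σ Z)           ≡⟨ cong (⊝ 𝟙 ⊕_) 𝟙⊕Z⊗𝟙⊕σZ ⟩
      ⊝ 𝟙 ⊕ 𝟙                       ≡⟨ ⊕-inverseˡ 𝟙 ⟩
      𝟘                             ∎)
      where
      open ≡-Reasoning
      u = 𝟙 ⊕ Z

    c₀-𝟙⊕½σZ : c₀ (𝟙 ⊕ const ½ ⊗ σ Z) ≡ 1ℚ
    c₀-𝟙⊕½σZ = begin
      c₀ (𝟙 ⊕ const ½ ⊗ σ Z)                   ≡⟨ c₀-⊕ 𝟙 (const ½ ⊗ σ Z) ⟩
      c₀ (𝟙 {n}) +q c₀ (const ½ ⊗ σ Z)         ≡⟨ cong₂ _+q_ (c₀-const {n} 1ℚ) (c₀-⊗ (const ½) (σ Z)) ⟩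
      1ℚ +q c₀ (const {n} ½) *q c₀ (σ Z)       ≡⟨ cong₂ (λ a b → 1ℚ +q a *q b) (c₀-const {n} ½) (trans (c₀-σ Z) c₀-Z) ⟩
      1ℚ +q ½ *q 0ℚ                            ≡⟨⟩
      1ℚ                                       ∎
      where open ≡-Reasoning

    c₀-𝟙⊕Z : c₀ (𝟙 ⊕ Z) ≡ 1ℚ
    c₀-𝟙⊕Z = trans (c₀-⊕ 𝟙 Z) (cong₂ _+q_ (c₀-const {n} 1ℚ) c₀-Z)

    σg-equation : (𝟙 ⊕ const ½ ⊗ σ Z) ⊗ σ g ≡ σ Z
    σg-equation = begin
      (𝟙 ⊕ const ½ ⊗ σ Z) ⊗ σ g             ≡⟨ cong₂ (λ a b → (a ⊕ b ⊗ σ Z) ⊗ σ g) (sym (σ-const 1ℚ)) (sym (σ-const ½)) ⟩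
      (σ 𝟙 ⊕ σ (const ½) ⊗ σ Z) ⊗ σ g       ≡⟨ cong (λ t → (σ 𝟙 ⊕ t) ⊗ σ g) (sym (σ-⊗ (const ½) Z)) ⟩
      (σ 𝟙 ⊕ σ (const ½ ⊗ Z)) ⊗ σ g         ≡⟨ cong (_⊗ σ g) (sym (σ-⊕ 𝟙 (const ½ ⊗ Z))) ⟩
      σ (𝟙 ⊕ const ½ ⊗ Z) ⊗ σ g             ≡⟨ sym (σ-⊗ _ g) ⟩
      σ ((𝟙 ⊕ const ½ ⊗ Z) ⊗ g)             ≡⟨ cong σ g-equation ⟩
      σ Z                                   ∎
      where open ≡-Reasoning

    -- Multiplying by the unit 1 + Z turns 1 + ½ σZ into 1 + ½ Z,
    -- since (1 + Z) σZ = - Z.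
    g-equation-twisted : (𝟙 ⊕ const ½ ⊗ σ Z) ⊗ g ≡ ⊝ σ Z
    g-equation-twisted = ⊗-cancelˡ (𝟙 ⊕ Z) c₀-𝟙⊕Z (begin
      u ⊗ ((𝟙 ⊕ half ⊗ σ Z) ⊗ g)        ≡⟨ sym (⊗-assoc u _ g) ⟩
      (u ⊗ (𝟙 ⊕ half ⊗ σ Z)) ⊗ g        ≡⟨ cong (_⊗ g) (⊗-distribˡ u 𝟙 (half ⊗ σ Z)) ⟩
      (u ⊗ 𝟙 ⊕ u ⊗ (half ⊗ σ Z)) ⊗ g    ≡⟨ cong₂ (λ a b → (a ⊕ b) ⊗ g) (⊗-identityʳ u) (⊗-swap u half (σ Z)) ⟩
      (u ⊕ half ⊗ (u ⊗ σ Z)) ⊗ g        ≡⟨ cong (λ t → (u ⊕ half ⊗ t) ⊗ g) 𝟙⊕Z⊗σZ ⟩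
      (u ⊕ half ⊗ ⊝ Z) ⊗ g              ≡⟨ cong (_⊗ g) (⊕-assoc 𝟙 Z (half ⊗ ⊝ Z)) ⟩
      (𝟙 ⊕ (Z ⊕ half ⊗ ⊝ Z)) ⊗ g        ≡⟨ cong (λ t → (𝟙 ⊕ t) ⊗ g) Z⊕half⊗⊝Z ⟩
      (𝟙 ⊕ half ⊗ Z) ⊗ g                ≡⟨ g-equation ⟩
      Z                                 ≡⟨ sym (⁻¹-involutive Z) ⟩
      ⊝ ⊝ Z                             ≡⟨ cong ⊝_ (sym 𝟙⊕Z⊗σZ) ⟩
      ⊝ (u ⊗ σ Z)                       ≡⟨ -‿distribʳ-* u (σ Z) ⟩
      u ⊗ ⊝ σ Z                         ∎)
      where
      open ≡-Reasoning
      u = 𝟙 ⊕ Z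
      half = const {n} ½
      Z⊕half⊗⊝Z : Z ⊕ half ⊗ ⊝ Z ≡ half ⊗ Z
      Z⊕half⊗⊝Z = begin
        Z ⊕ half ⊗ ⊝ Z          ≡⟨ cong₂ _⊕_ (sym (⊗-identityˡ Z)) (sym (-‿distribʳ-* half Z)) ⟩
        𝟙 ⊗ Z ⊕ ⊝ (half ⊗ Z)    ≡⟨ cong (𝟙 ⊗ Z ⊕_) (-‿distribˡ-* half Z) ⟩
        𝟙 ⊗ Z ⊕ ⊝ half ⊗ Z      ≡⟨ sym (⊗-distribʳ Z 𝟙 (⊝ half)) ⟩
        (𝟙 ⊕ ⊝ half) ⊗ Z        ≡⟨ cong (λ t → (𝟙 ⊕ t) ⊗ Z) (sym (const-neg ½)) ⟩
        (𝟙 ⊕ const (-q ½)) ⊗ Z  ≡⟨ cong (_⊗ Z) (sym (const-+ 1ℚ (-q ½))) ⟩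
        half ⊗ Z                ∎

    σg≡⊝g : σ g ≡ ⊝ g
    σg≡⊝g = ⊗-cancelˡ (𝟙 ⊕ const ½ ⊗ σ Z) c₀-𝟙⊕½σZ (begin
      v ⊗ σ g      ≡⟨ σg-equation ⟩
      σ Z          ≡⟨ sym (⁻¹-involutive (σ Z)) ⟩
      ⊝ ⊝ σ Z      ≡⟨ cong ⊝_ (sym g-equation-twisted) ⟩
      ⊝ (v ⊗ g)    ≡⟨ -‿distribʳ-* v g ⟩
      v ⊗ ⊝ g      ∎)
      where
      open ≡-Reasoning
      v = 𝟙 ⊕ const ½ ⊗ σ Z

    -- σ g = - g kills the homogeneous parts of g of even degree.
    h₁-odd≡𝟘 : ∀ j → even j ≡ false → h 1 j ≡ 𝟘
    h₁-odd≡𝟘 j odd-j = coeff-ext λ K → trans (at-h₁ K) (sym (at-𝟘 K))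
      where
      at-h₁ : ∀ K → h 1 j at K ≡ 0ℚ
      at-h₁ K with ∣ K ∣ ℕ.≟ suc j
      ... | no ∣K∣≢1+j  = Homogeneous⇒at≡0 (suc j) K (Homogeneous-h 1 j) ∣K∣≢1+j
      ... | yes ∣K∣≡1+j = trans (sym g≡h₁) (x≡-x⇒x≡0 (g at K) (begin
        g at K                     ≡⟨ sym (ℚₚ.*-identityˡ (g at K)) ⟩
        1ℚ *q g at K               ≡⟨ cong (_*q g at K) (sym (sign-even ∣ K ∣ even-∣K∣)) ⟩
        sign ∣ K ∣ *q g at K       ≡⟨ sym (at-σ g K) ⟩
        σ g at K                   ≡⟨ cong (_at K) σg≡⊝g ⟩
        (⊝ g) at K                 ≡⟨ at-⊝ g K ⟩
        -q g at K                  ∎))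
        where
        open ≡-Reasoning
        even-∣K∣ : even ∣ K ∣ ≡ true
        even-∣K∣ = trans (cong even ∣K∣≡1+j) (trans (even-suc j) (cong not odd-j))
        g≡h₁ : g at K ≡ h 1 j at K
        g≡h₁ = trans (at-∑ (upTo (suc n)) (h 1) K)
          (∑ℚ-upTo-single (λ i → h 1 i at K) (suc n) (s≤s (ℕₚ.<⇒≤ (subst (_≤ n) ∣K∣≡1+j (∣p∣≤n K))))
            (λ i i≢j → Homogeneous⇒at≡0 (suc i) K (Homogeneous-h 1 i) (λ ∣K∣≡1+i → i≢j (ℕₚ.suc-injective (trans (sym ∣K∣≡1+i) ∣K∣≡1+j)))))

words : {A : Set} → List A → ℕ → List (List A)
words letters zero    = [] ∷ []
words letters (suc m) = concatMap (λ x → map (x ∷_) (words letters m)) letters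

∑-words-suc : ∀ {n} {A : Set} (letters : List A) m (f : List A → 𝔸 n) →
              ∑ (words letters (suc m)) f ≡ ∑ letters (λ x → ∑ (words letters m) (f ∘ (x ∷_)))
∑-words-suc letters m f =
  trans (∑-concatMap _ letters f) (∑-cong letters (λ x → ∑-map (x ∷_) (words letters m) f))

∑-words-cong : ∀ {n} {A : Set} (letters : List A) m {f g : List A → 𝔸 n} →
               (∀ u → length u ≡ m → f u ≡ g u) → ∑ (words letters m) f ≡ ∑ (words letters m) g
∑-words-cong letters zero    h = cong (_⊕ 𝟘) (h [] refl)
∑-words-cong letters (suc m) {f} {g} h = begin
  ∑ (words letters (suc m)) f                          ≡⟨ ∑-words-suc letters m f ⟩
  ∑ letters (λ x → ∑ (words letters m) (f ∘ (x ∷_)))   ≡⟨ ∑-cong letters (λ x →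
                                                            ∑-words-cong letters m (λ u ∣u∣≡m → h (x ∷ u) (cong suc ∣u∣≡m))) ⟩
  ∑ letters (λ x → ∑ (words letters m) (g ∘ (x ∷_)))   ≡⟨ sym (∑-words-suc letters m g) ⟩
  ∑ (words letters (suc m)) g                          ∎
  where open ≡-Reasoning

letterwise : {A B : Set} → (A → B → ℚ) → List A → List B → ℚ
letterwise f []      []      = 1ℚ
letterwise f (x ∷ u) (y ∷ w) = f x y *q letterwise f u w
letterwise f _       _       = 0ℚ

letterwise-length : {A B : Set} (f : A → B → ℚ) (u : List A) (w : List B) → ¬ length u ≡ length w → letterwise f u w ≡ 0ℚ
letterwise-length f []      []      ∣u∣≢∣w∣ = ⊥-elim (∣u∣≢∣w∣ refl)
letterwise-length f []      (y ∷ w) ∣u∣≢∣w∣ = refl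
letterwise-length f (x ∷ u) []      ∣u∣≢∣w∣ = refl
letterwise-length f (x ∷ u) (y ∷ w) ∣u∣≢∣w∣ =
  trans (cong (f x y *q_) (letterwise-length f u w (∣u∣≢∣w∣ ∘ cong suc))) (ℚₚ.*-zeroʳ (f x y))

∑-letterwise : {A B C : Set} (f : A → B → ℚ) (g : B → C → ℚ) (bs : List B) (m : ℕ) (u : List A) (w : List C) →
               length u ≡ m →
               ∑ℚ (words bs m) (λ t → letterwise f u t *q letterwise g t w)
               ≡ letterwise (λ x z → ∑ℚ bs (λ y → f x y *q g y z)) u w
∑-letterwise f g bs zero    [] []      _ = trans (ℚₚ.+-identityʳ _) (ℚₚ.*-identityˡ 1ℚ)
∑-letterwise f g bs zero    [] (z ∷ w) _ = trans (ℚₚ.+-identityʳ _) (ℚₚ.*-zeroʳ 1ℚ)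
∑-letterwise f g bs (suc m) (x ∷ u) w ∣u∣≡1+m = begin
  ∑ℚ (words bs (suc m)) (λ t → letterwise f (x ∷ u) t *q letterwise g t w)
    ≡⟨ ∑-words-suc bs m _ ⟩
  ∑ℚ bs (λ y → ∑ℚ (words bs m) (λ t → (f x y *q letterwise f u t) *q letterwise g (y ∷ t) w))
    ≡⟨ by-head w ⟩
  letterwise (λ x z → ∑ℚ bs (λ y → f x y *q g y z)) (x ∷ u) w  ∎
  where
  open ≡-Reasoning
  ∣u∣≡m = ℕₚ.suc-injective ∣u∣≡1+m
  by-head : ∀ w → ∑ℚ bs (λ y → ∑ℚ (words bs m) (λ t → (f x y *q letterwise f u t) *q letterwise g (y ∷ t) w))
                  ≡ letterwise (λ x z → ∑ℚ bs (λ y → f x y *q g y z)) (x ∷ u) w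
  by-head []      = ∑-𝟘 bs (λ y → ∑-𝟘 (words bs m) (λ t → ℚₚ.*-zeroʳ (f x y *q letterwise f u t)))
  by-head (z ∷ w) = begin
    ∑ℚ bs (λ y → ∑ℚ (words bs m) (λ t → (f x y *q letterwise f u t) *q (g y z *q letterwise g t w)))
      ≡⟨ ∑-cong bs (λ y → ∑-cong (words bs m) (λ t → interchange (f x y) (letterwise f u t) (g y z) _)) ⟩
    ∑ℚ bs (λ y → ∑ℚ (words bs m) (λ t → (f x y *q g y z) *q (letterwise f u t *q letterwise g t w)))
      ≡⟨ ∑-cong bs (λ y → ∑-⊗ˡ (words bs m) (f x y *q g y z) _) ⟩
    ∑ℚ bs (λ y → (f x y *q g y z) *q ∑ℚ (words bs m) (λ t → letterwise f u t *q letterwise g t w))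
      ≡⟨ ∑-⊗ʳ bs _ (λ y → f x y *q g y z) ⟩
    ∑ℚ bs (λ y → f x y *q g y z) *q ∑ℚ (words bs m) (λ t → letterwise f u t *q letterwise g t w)
      ≡⟨ cong (∑ℚ bs (λ y → f x y *q g y z) *q_) (∑-letterwise f g bs m u w ∣u∣≡m) ⟩
    letterwise (λ x z → ∑ℚ bs (λ y → f x y *q g y z)) (x ∷ u) (z ∷ w)  ∎
    where interchange = CommutativeSemigroupProperties.interchange (CommutativeRing.*-commutativeSemigroup ℚₚ.+-*-commutativeRing)

letterwise-cong : {A B : Set} {f g : A → B → ℚ} → (∀ x y → f x y ≡ g x y) → (u : List A) (w : List B) → letterwise f u w ≡ letterwise g u w
letterwise-cong h []      []      = refl
letterwise-cong h []      (y ∷ w) = refl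
letterwise-cong h (x ∷ u) []      = refl
letterwise-cong h (x ∷ u) (y ∷ w) = cong₂ _*q_ (h x y) (letterwise-cong h u w)

ab : List AB
ab = 𝐚 ∷ 𝐛 ∷ []

∑-words-ab : ∀ {n} m (f : List AB → 𝔸 n) →
             ∑ (words ab (suc m)) f ≡ ∑ (words ab m) (f ∘ (𝐚 ∷_)) ⊕ ∑ (words ab m) (f ∘ (𝐛 ∷_))
∑-words-ab m f = trans (∑-words-suc ab m f) (cong (∑ (words ab m) (f ∘ (𝐚 ∷_)) ⊕_) (⊕-identityʳ _))

∑-words-==W : ∀ m w (X : List AB → ℚ) →
              ∑ℚ (words ab m) (λ v → if v ==W w then X v else 0ℚ) ≡ (if length w ≡ᵇ m then X w else 0ℚ)
∑-words-==W zero    []      X = ℚₚ.+-identityʳ (X [])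
∑-words-==W zero    (y ∷ w) X = refl
∑-words-==W (suc m) []      X = trans (∑-words-ab m _)
  (cong₂ _+q_ (∑-𝟘 (words ab m) (λ _ → refl)) (∑-𝟘 (words ab m) (λ _ → refl)))
∑-words-==W (suc m) (𝐚 ∷ w) X = begin
  ∑ℚ (words ab (suc m)) (λ v → if v ==W (𝐚 ∷ w) then X v else 0ℚ)
    ≡⟨ ∑-words-ab m _ ⟩
  ∑ℚ (words ab m) (λ v → if v ==W w then X (𝐚 ∷ v) else 0ℚ) +q ∑ℚ (words ab m) (λ _ → 0ℚ)
    ≡⟨ cong₂ _+q_ (∑-words-==W m w (X ∘ (𝐚 ∷_))) (∑-𝟘 (words ab m) (λ _ → refl)) ⟩
  (if length w ≡ᵇ m then X (𝐚 ∷ w) else 0ℚ) +q 0ℚ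
    ≡⟨ ℚₚ.+-identityʳ _ ⟩
  (if length w ≡ᵇ m then X (𝐚 ∷ w) else 0ℚ)  ∎
  where open ≡-Reasoning
∑-words-==W (suc m) (𝐛 ∷ w) X = begin
  ∑ℚ (words ab (suc m)) (λ v → if v ==W (𝐛 ∷ w) then X v else 0ℚ)
    ≡⟨ ∑-words-ab m _ ⟩
  ∑ℚ (words ab m) (λ _ → 0ℚ) +q ∑ℚ (words ab m) (λ v → if v ==W w then X (𝐛 ∷ v) else 0ℚ)
    ≡⟨ cong₂ _+q_ (∑-𝟘 (words ab m) (λ _ → refl)) (∑-words-==W m w (X ∘ (𝐛 ∷_))) ⟩
  0ℚ +q (if length w ≡ᵇ m then X (𝐛 ∷ w) else 0ℚ)
    ≡⟨ ℚₚ.+-identityˡ _ ⟩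
  (if length w ≡ᵇ m then X (𝐛 ∷ w) else 0ℚ)  ∎
  where open ≡-Reasoning

applyUpTo-cong : ∀ {A : Set} {f g : ℕ → A} → (∀ i → f i ≡ g i) → ∀ L → applyUpTo f L ≡ applyUpTo g L
applyUpTo-cong h zero    = refl
applyUpTo-cong h (suc L) = cong₂ _∷_ (h 0) (applyUpTo-cong (h ∘ suc) L)

-- The composition whose word u_α is v, with r added to its first part.
composition : ℕ → List AB → List ℕ
composition r []      = r ∷ []
composition r (𝐚 ∷ v) = composition (suc r) v
composition r (𝐛 ∷ v) = r ∷ composition 1 v

compositionsF-fuel : ∀ f f′ k → k ≤ f → k ≤ f′ → compositionsF f k ≡ compositionsF f′ k
compositionsF-fuel f       f′       zero    _         _          = refl
compositionsF-fuel (suc f) (suc f′) (suc k) (s≤s k≤f) (s≤s k≤f′) = Listₚ.concatMap-cong (λ a →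
  cong (map (suc a ∷_)) (compositionsF-fuel f f′ (k ∸ a)
    (ℕₚ.≤-trans (ℕₚ.m∸n≤m k a) k≤f) (ℕₚ.≤-trans (ℕₚ.m∸n≤m k a) k≤f′))) (upTo (suc k))

∑-compositions-suc : ∀ {n} m (F : List ℕ → 𝔸 n) →
  ∑ (compositions (suc m)) F ≡ ∑ (upTo (suc m)) (λ a → ∑ (compositions (m ∸ a)) (λ α → F (suc a ∷ α)))
∑-compositions-suc m F =
  trans (∑-concatMap (λ a → map (suc a ∷_) (compositionsF m (m ∸ a))) (upTo (suc m)) F)
        (∑-cong (upTo (suc m)) λ a → trans (∑-map (suc a ∷_) (compositionsF m (m ∸ a)) F)
          (cong (λ l → ∑ l (λ α → F (suc a ∷ α))) (compositionsF-fuel m (m ∸ a) (m ∸ a) (ℕₚ.m∸n≤m m a) ℕₚ.≤-refl)))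

∑-words-composition : ∀ {n} m r (F : List ℕ → 𝔸 n) →
  ∑ (words ab m) (F ∘ composition r) ≡ ∑ (upTo (suc m)) (λ a → ∑ (compositions (m ∸ a)) (λ α → F (r + a ∷ α)))
∑-words-composition zero    r F =
  trans (cong (λ t → F (t ∷ []) ⊕ 𝟘) (sym (ℕₚ.+-identityʳ r))) (sym (⊕-identityʳ _))
∑-words-composition (suc m) r F = begin
  ∑ (words ab (suc m)) (F ∘ composition r)
    ≡⟨ ∑-words-ab m _ ⟩
  ∑ (words ab m) (F ∘ composition (suc r)) ⊕ ∑ (words ab m) (λ v → F (r ∷ composition 1 v))
    ≡⟨ cong₂ _⊕_ (∑-words-composition m (suc r) F) (∑-words-composition m 1 (F ∘ (r ∷_))) ⟩
  ∑ (upTo (suc m)) (λ a → ∑ (compositions (m ∸ a)) (λ α → F (suc r + a ∷ α)))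
    ⊕ ∑ (upTo (suc m)) (λ a → ∑ (compositions (m ∸ a)) (λ α → F (r ∷ suc a ∷ α)))
    ≡⟨ cong₂ _⊕_ (∑-cong (upTo (suc m)) (λ a → ∑-cong (compositions (m ∸ a)) (λ α →
                   cong (λ t → F (t ∷ α)) (sym (ℕₚ.+-suc r a)))))
                 (sym (∑-compositions-suc m (F ∘ (r ∷_)))) ⟩
  ∑ (upTo (suc m)) (λ a → ∑ (compositions (m ∸ a)) (λ α → F (r + suc a ∷ α)))
    ⊕ ∑ (compositions (suc m)) (F ∘ (r ∷_))
    ≡⟨ ⊕-comm _ _ ⟩
  ∑ (compositions (suc m)) (F ∘ (r ∷_))
    ⊕ ∑ (upTo (suc m)) (λ a → ∑ (compositions (m ∸ a)) (λ α → F (r + suc a ∷ α)))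
    ≡⟨ cong₂ _⊕_ (∑-cong (compositions (suc m)) (λ α → cong (λ t → F (t ∷ α)) (sym (ℕₚ.+-identityʳ r))))
                 (sym (∑-applyUpTo suc (suc m) _)) ⟩
  ∑ (upTo (suc (suc m))) (λ a → ∑ (compositions (suc m ∸ a)) (λ α → F (r + a ∷ α)))  ∎
  where open ≡-Reasoning

∑-compositions : ∀ {n} m (F : List ℕ → 𝔸 n) → ∑ (compositions (suc m)) F ≡ ∑ (words ab m) (F ∘ composition 1)
∑-compositions m F = trans (∑-compositions-suc m F) (sym (∑-words-composition m 1 F))

bPositions : ℕ → List AB → List ℕ
bPositions k []      = []
bPositions k (𝐚 ∷ v) = bPositions (suc k) v
bPositions k (𝐛 ∷ v) = k ∷ bPositions (suc k) v

composition-nonempty : ∀ r v → Σ ℕ (λ a → Σ (List ℕ) (λ α → composition r v ≡ a ∷ α))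
composition-nonempty r []      = r , [] , refl
composition-nonempty r (𝐚 ∷ v) = composition-nonempty (suc r) v
composition-nonempty r (𝐛 ∷ v) = r , composition 1 v , refl

map-+-bPositions : ∀ k r v → map (λ x → k + x) (bPositions r v) ≡ bPositions (k + r) v
map-+-bPositions k r []      = refl
map-+-bPositions k r (𝐚 ∷ v) = trans (map-+-bPositions k (suc r) v) (cong (λ t → bPositions t v) (ℕₚ.+-suc k r))
map-+-bPositions k r (𝐛 ∷ v) =
  cong (k + r ∷_) (trans (map-+-bPositions k (suc r) v) (cong (λ t → bPositions t v) (ℕₚ.+-suc k r)))

Sset-composition : ∀ r v → Sset (composition r v) ≡ bPositions r v
Sset-composition r []      = refl
Sset-composition r (𝐚 ∷ v) = Sset-composition (suc r) v
Sset-composition r (𝐛 ∷ v) with composition-nonempty 1 v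
... | a , α , α≡ rewrite α≡ = cong (r ∷_) (begin
  map (λ x → r + x) (Sset (a ∷ α))               ≡⟨ cong (map (λ x → r + x) ∘ Sset) (sym α≡) ⟩
  map (λ x → r + x) (Sset (composition 1 v))     ≡⟨ cong (map (λ x → r + x)) (Sset-composition 1 v) ⟩
  map (λ x → r + x) (bPositions 1 v)             ≡⟨ map-+-bPositions r 1 v ⟩
  bPositions (r + 1) v                    ≡⟨ cong (λ t → bPositions t v) (ℕₚ.+-comm r 1) ⟩
  bPositions (suc r) v                    ∎)
  where open ≡-Reasoning

sum-composition : ∀ r v → sum (composition r v) ≡ r + length v
sum-composition r []      = refl
sum-composition r (𝐚 ∷ v) = trans (sum-composition (suc r) v) (sym (ℕₚ.+-suc r (length v)))
sum-composition r (𝐛 ∷ v) = cong (λ x → r + x) (sum-composition 1 v)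

#𝐛 : List AB → ℕ
#𝐛 []      = 0
#𝐛 (𝐚 ∷ v) = #𝐛 v
#𝐛 (𝐛 ∷ v) = suc (#𝐛 v)

length-composition : ∀ r v → length (composition r v) ≡ suc (#𝐛 v)
length-composition r []      = refl
length-composition r (𝐚 ∷ v) = length-composition (suc r) v
length-composition r (𝐛 ∷ v) = cong suc (length-composition 1 v)

≡ᵇ-false : ∀ i k → ¬ i ≡ k → (i ≡ᵇ k) ≡ false
≡ᵇ-false i k i≢k = dec-false (i ℕ.≟ k) i≢k

≡ᵇ-refl : ∀ k → (k ≡ᵇ k) ≡ true
≡ᵇ-refl k = dec-true (k ℕ.≟ k) refl

∉-bPositions : ∀ i k v → i < k → i ∈ℕᵇ bPositions k v ≡ false
∉-bPositions i k []      i<k = refl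
∉-bPositions i k (𝐚 ∷ v) i<k = ∉-bPositions i (suc k) v (ℕₚ.m≤n⇒m≤1+n i<k)
∉-bPositions i k (𝐛 ∷ v) i<k
  rewrite ≡ᵇ-false i k (ℕₚ.<⇒≢ i<k) = ∉-bPositions i (suc k) v (ℕₚ.m≤n⇒m≤1+n i<k)

∈-bPositions-∷ : ∀ i k x v → ¬ i ≡ k → i ∈ℕᵇ bPositions k (x ∷ v) ≡ i ∈ℕᵇ bPositions (suc k) v
∈-bPositions-∷ i k 𝐚 v i≢k = refl
∈-bPositions-∷ i k 𝐛 v i≢k rewrite ≡ᵇ-false i k i≢k = refl

is𝐛 : AB → Bool
is𝐛 𝐚 = false
is𝐛 𝐛 = true

∈-bPositions-head : ∀ k x v → k ∈ℕᵇ bPositions k (x ∷ v) ≡ is𝐛 x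
∈-bPositions-head k 𝐚 v = ∉-bPositions k (suc k) v ℕₚ.≤-refl
∈-bPositions-head k 𝐛 v rewrite ≡ᵇ-refl k = refl

letter-is𝐛 : ∀ x → (if is𝐛 x then 𝐛 else 𝐚) ≡ x
letter-is𝐛 𝐚 = refl
letter-is𝐛 𝐛 = refl

word-bPositions : ∀ k v → applyUpTo (λ j → if (k + j) ∈ℕᵇ bPositions k v then 𝐛 else 𝐚) (length v) ≡ v
word-bPositions k []      = refl
word-bPositions k (x ∷ v) = cong₂ _∷_ head (trans (applyUpTo-cong tail-letter (length v)) (word-bPositions (suc k) v))
  where
  head : (if (k + 0) ∈ℕᵇ bPositions k (x ∷ v) then 𝐛 else 𝐚) ≡ x
  head rewrite ℕₚ.+-identityʳ k | ∈-bPositions-head k x v = letter-is𝐛 x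
  tail-letter : ∀ j → (if (k + suc j) ∈ℕᵇ bPositions k (x ∷ v) then 𝐛 else 𝐚)
                    ≡ (if (suc k + j) ∈ℕᵇ bPositions (suc k) v then 𝐛 else 𝐚)
  tail-letter j = cong (if_then 𝐛 else 𝐚) (trans (∈-bPositions-∷ (k + suc j) k x v (ℕₚ.m+1+n≢m k))
                                                 (cong (_∈ℕᵇ bPositions (suc k) v) (ℕₚ.+-suc k j)))

uWord-composition : ∀ v → uWord (composition 1 v) ≡ v
uWord-composition v = begin
  map letter (applyUpTo suc (sum (composition 1 v) ∸ 1))  ≡⟨ cong (λ t → map letter (applyUpTo suc (t ∸ 1))) (sum-composition 1 v) ⟩
  map letter (applyUpTo suc (length v))                   ≡⟨ Listₚ.map-applyUpTo suc letter (length v) ⟩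
  applyUpTo (letter ∘ suc) (length v)                     ≡⟨ applyUpTo-cong (λ j → cong (λ S → if suc j ∈ℕᵇ S then 𝐛 else 𝐚)
                                                               (Sset-composition 1 v)) (length v) ⟩
  applyUpTo (λ j → if (1 + j) ∈ℕᵇ bPositions 1 v then 𝐛 else 𝐚) (length v)  ≡⟨ word-bPositions 1 v ⟩
  v                                                       ∎
  where
  open ≡-Reasoning
  letter = λ i → if i ∈ℕᵇ Sset (composition 1 v) then 𝐛 else 𝐚

_⊑_ : List AB → List AB → Bool
[]      ⊑ []      = true
(𝐚 ∷ u) ⊑ (_ ∷ w) = u ⊑ w
(𝐛 ∷ u) ⊑ (𝐚 ∷ w) = false
(𝐛 ∷ u) ⊑ (𝐛 ∷ w) = u ⊑ w
_       ⊑ _       = false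

All-≤-bPositions : ∀ k u → All (k ≤_) (bPositions k u)
All-≤-bPositions k []      = []
All-≤-bPositions k (𝐚 ∷ u) = All.map ℕₚ.<⇒≤ (All-≤-bPositions (suc k) u)
All-≤-bPositions k (𝐛 ∷ u) = ℕₚ.≤-refl ∷ All.map ℕₚ.<⇒≤ (All-≤-bPositions (suc k) u)

all-cong-All : ∀ {P : ℕ → Set} (p q : ℕ → Bool) (l : List ℕ) → All P l → (∀ x → P x → p x ≡ q x) → all p l ≡ all q l
all-cong-All p q []      []         h = refl
all-cong-All p q (x ∷ l) (px ∷ pl) h = cong₂ _∧_ (h x px) (all-cong-All p q l pl h)

⊆-bPositions : ∀ k u w → length u ≡ length w → all (_∈ℕᵇ bPositions k w) (bPositions k u) ≡ u ⊑ w
⊆-bPositions k []      []      _ = refl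
⊆-bPositions k (𝐚 ∷ u) (y ∷ w) ∣u∣≡∣w∣ =
  trans (all-cong-All _ _ (bPositions (suc k) u) (All-≤-bPositions (suc k) u) (λ i k<i → ∈-bPositions-∷ i k y w (ℕₚ.>⇒≢ k<i)))
        (⊆-bPositions (suc k) u w (ℕₚ.suc-injective ∣u∣≡∣w∣))
⊆-bPositions k (𝐛 ∷ u) (y ∷ w) ∣u∣≡∣w∣ = trans
  (cong₂ _∧_ (∈-bPositions-head k y w)
    (trans (all-cong-All _ _ (bPositions (suc k) u) (All-≤-bPositions (suc k) u) (λ i k<i → ∈-bPositions-∷ i k y w (ℕₚ.>⇒≢ k<i)))
           (⊆-bPositions (suc k) u w (ℕₚ.suc-injective ∣u∣≡∣w∣))))
  (by-letter y)
  where
  by-letter : ∀ y → (is𝐛 y ∧ u ⊑ w) ≡ (𝐛 ∷ u) ⊑ (y ∷ w)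
  by-letter 𝐚 = refl
  by-letter 𝐛 = refl

⪯ᵇ-composition : ∀ u w → length u ≡ length w → (composition 1 u ⪯ᵇ composition 1 w) ≡ u ⊑ w
⪯ᵇ-composition u w ∣u∣≡∣w∣ = trans
  (cong₂ (λ Sα Sβ → all (_∈ℕᵇ Sα) Sβ) (Sset-composition 1 w) (Sset-composition 1 u))
  (⊆-bPositions 1 u w ∣u∣≡∣w∣)

⊑⇒#𝐛≤ : ∀ u w → u ⊑ w ≡ true → #𝐛 u ≤ #𝐛 w
⊑⇒#𝐛≤ []      []      _   = z≤n
⊑⇒#𝐛≤ (𝐚 ∷ u) (𝐚 ∷ w) u⊑w = ⊑⇒#𝐛≤ u w u⊑w
⊑⇒#𝐛≤ (𝐚 ∷ u) (𝐛 ∷ w) u⊑w = ℕₚ.m≤n⇒m≤1+n (⊑⇒#𝐛≤ u w u⊑w)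
⊑⇒#𝐛≤ (𝐛 ∷ u) (𝐛 ∷ w) u⊑w = s≤s (⊑⇒#𝐛≤ u w u⊑w)

-- In a flag h-vector, ζ_β enters η_α with sign (-1)^{k(α)-k(β)} when
-- β ⪯ α; letterwise, u_β ↦ u_α with 𝐚 ↦ 𝐚 - 𝐛 and 𝐛 ↦ 𝐛.
ζ→ab : AB → AB → ℚ
ζ→ab 𝐚 𝐚 = 1ℚ
ζ→ab 𝐚 𝐛 = -q 1ℚ
ζ→ab 𝐛 𝐚 = 0ℚ
ζ→ab 𝐛 𝐛 = 1ℚ

letterwise-ζ→ab : ∀ u w → length u ≡ length w →
                  letterwise ζ→ab u w ≡ (if u ⊑ w then sign (#𝐛 w ∸ #𝐛 u) else 0ℚ)
letterwise-ζ→ab []      []      _       = refl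
letterwise-ζ→ab (𝐚 ∷ u) (𝐚 ∷ w) ∣u∣≡∣w∣ =
  trans (ℚₚ.*-identityˡ _) (letterwise-ζ→ab u w (ℕₚ.suc-injective ∣u∣≡∣w∣))
letterwise-ζ→ab (𝐛 ∷ u) (𝐛 ∷ w) ∣u∣≡∣w∣ =
  trans (ℚₚ.*-identityˡ _) (letterwise-ζ→ab u w (ℕₚ.suc-injective ∣u∣≡∣w∣))
letterwise-ζ→ab (𝐛 ∷ u) (𝐚 ∷ w) _       = ℚₚ.*-zeroˡ (letterwise ζ→ab u w)
letterwise-ζ→ab (𝐚 ∷ u) (𝐛 ∷ w) ∣u∣≡∣w∣
  with u ⊑ w in u⊑w | letterwise-ζ→ab u w (ℕₚ.suc-injective ∣u∣≡∣w∣)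
... | false | IH = trans (cong (-q 1ℚ *q_) IH) (ℚₚ.*-zeroʳ (-q 1ℚ))
... | true  | IH = begin
  -q 1ℚ *q letterwise ζ→ab u w    ≡⟨ cong (-q 1ℚ *q_) IH ⟩
  -q 1ℚ *q sign (#𝐛 w ∸ #𝐛 u)     ≡⟨ sym (ℚₚ.neg-distribˡ-* 1ℚ (sign (#𝐛 w ∸ #𝐛 u))) ⟩
  -q (1ℚ *q sign (#𝐛 w ∸ #𝐛 u))   ≡⟨ cong -q_ (ℚₚ.*-identityˡ (sign (#𝐛 w ∸ #𝐛 u))) ⟩
  sign (suc (#𝐛 w ∸ #𝐛 u))        ≡⟨ cong sign (sym (ℕₚ.+-∸-assoc 1 (⊑⇒#𝐛≤ u w u⊑w))) ⟩
  sign (suc (#𝐛 w) ∸ #𝐛 u)        ∎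
  where open ≡-Reasoning

coeff-map : ∀ (f : List ℕ → ℚ × List AB) (xs : List (List ℕ)) w →
            coeff (map f xs) w ≡ ∑ℚ xs (λ α → if proj₂ (f α) ==W w then proj₁ (f α) else 0ℚ)
coeff-map f []       w = refl
coeff-map f (α ∷ xs) w = cong ((if proj₂ (f α) ==W w then proj₁ (f α) else 0ℚ) +q_) (coeff-map f xs w)

ι-η : ∀ m (B : Subset (suc m) → Bool) w → length w ≡ m →
      ι (η B (composition 1 w)) ≡ ∑ℚ (words ab m) (λ u → ι (+ ζ B (composition 1 u)) *q letterwise ζ→ab u w)
ι-η m B w ∣w∣≡m = begin
  ι (η B α)
    ≡⟨ ι-sumℤ term (filterᵇ (_⪯ᵇ α) (compositions (suc m))) ⟩
  ∑ℚ (filterᵇ (_⪯ᵇ α) (compositions (suc m))) (ι ∘ term)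
    ≡⟨ ∑-filterᵇ (_⪯ᵇ α) (compositions (suc m)) (ι ∘ term) ⟩
  ∑ℚ (compositions (suc m)) (λ β → if β ⪯ᵇ α then ι (term β) else 0ℚ)
    ≡⟨ ∑-compositions m _ ⟩
  ∑ℚ (words ab m) (λ u → if composition 1 u ⪯ᵇ α then ι (term (composition 1 u)) else 0ℚ)
    ≡⟨ ∑-words-cong ab m by-word ⟩
  ∑ℚ (words ab m) (λ u → ι (+ ζ B (composition 1 u)) *q letterwise ζ→ab u w)  ∎
  where
  open ≡-Reasoning
  α = composition 1 w
  term = λ β → ((ℤ.- + 1) ℤ.^ (length α ∸ length β)) ℤ.* (+ ζ B β)
  by-word : ∀ u → length u ≡ m → (if composition 1 u ⪯ᵇ α then ι (term (composition 1 u)) else 0ℚ)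
                                 ≡ ι (+ ζ B (composition 1 u)) *q letterwise ζ→ab u w
  by-word u ∣u∣≡m = begin
    (if composition 1 u ⪯ᵇ α then ι (term (composition 1 u)) else 0ℚ)
      ≡⟨ cong₂ (if_then_else 0ℚ) (⪯ᵇ-composition u w ∣u∣≡∣w∣) (ι-* (sgn (length α ∸ length (composition 1 u))) ζu) ⟩
    (if u ⊑ w then ι (sgn (length α ∸ length (composition 1 u))) *q ι ζu else 0ℚ)
      ≡⟨ cong (λ s → if u ⊑ w then s *q ι ζu else 0ℚ) (trans (ι-sign (length α ∸ length (composition 1 u)))
           (cong sign (cong₂ _∸_ (length-composition 1 w) (length-composition 1 u)))) ⟩
    (if u ⊑ w then sign (#𝐛 w ∸ #𝐛 u) *q ι ζu else 0ℚ)
      ≡⟨ pull-out (u ⊑ w) ⟩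
    ι ζu *q (if u ⊑ w then sign (#𝐛 w ∸ #𝐛 u) else 0ℚ)
      ≡⟨ cong (ι ζu *q_) (sym (letterwise-ζ→ab u w ∣u∣≡∣w∣)) ⟩
    ι ζu *q letterwise ζ→ab u w  ∎
    where
    ζu = + ζ B (composition 1 u)
    sgn = λ k → (ℤ.- + 1) ℤ.^ k
    ∣u∣≡∣w∣ = trans ∣u∣≡m (sym ∣w∣≡m)
    pull-out : ∀ b → (if b then sign (#𝐛 w ∸ #𝐛 u) *q ι ζu else 0ℚ) ≡ ι ζu *q (if b then sign (#𝐛 w ∸ #𝐛 u) else 0ℚ)
    pull-out true  = ℚₚ.*-comm (sign (#𝐛 w ∸ #𝐛 u)) (ι ζu)
    pull-out false = sym (ℚₚ.*-zeroʳ (ι ζu))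

coeff-Ψ : ∀ m (B : Subset (suc m) → Bool) w →
          coeff (Ψ B) w ≡ ∑ℚ (words ab m) (λ u → ι (+ ζ B (composition 1 u)) *q letterwise ζ→ab u w)
coeff-Ψ m B w = begin
  coeff (Ψ B) w
    ≡⟨ coeff-map (λ α → η B α / 1 , uWord α) (compositions (suc m)) w ⟩
  ∑ℚ (compositions (suc m)) (λ α → if uWord α ==W w then ι (η B α) else 0ℚ)
    ≡⟨ ∑-compositions m (λ α → if uWord α ==W w then ι (η B α) else 0ℚ) ⟩
  ∑ℚ (words ab m) (λ v → if uWord (composition 1 v) ==W w then X v else 0ℚ)
    ≡⟨ ∑-cong (words ab m) (λ v → cong (λ u → if u ==W w then X v else 0ℚ) (uWord-composition v)) ⟩
  ∑ℚ (words ab m) (λ v → if v ==W w then X v else 0ℚ)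
    ≡⟨ ∑-words-==W m w X ⟩
  (if length w ≡ᵇ m then X w else 0ℚ)
    ≡⟨ by-length (length w ℕ.≟ m) ⟩
  ∑ℚ (words ab m) (λ u → ζu u *q letterwise ζ→ab u w)  ∎
  where
  open ≡-Reasoning
  X = λ v → ι (η B (composition 1 v))
  ζu = λ u → ι (+ ζ B (composition 1 u))
  by-length : Dec (length w ≡ m) →
    (if length w ≡ᵇ m then X w else 0ℚ) ≡ ∑ℚ (words ab m) (λ u → ζu u *q letterwise ζ→ab u w)
  by-length (yes ∣w∣≡m) = trans (cong (if_then X w else 0ℚ) (trans (cong (_≡ᵇ m) ∣w∣≡m) (≡ᵇ-refl m)))
                                (ι-η m B w ∣w∣≡m)
  by-length (no ∣w∣≢m)  = trans (cong (if_then X w else 0ℚ) (≡ᵇ-false (length w) m ∣w∣≢m))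
    (sym (trans (∑-words-cong ab m (λ u ∣u∣≡m → trans (cong (ζu u *q_) (letterwise-length ζ→ab u w
                                                      (λ ∣u∣≡∣w∣ → ∣w∣≢m (trans (sym ∣u∣≡∣w∣) ∣u∣≡m))))
                                                    (ℚₚ.*-zeroʳ (ζu u))))
                (∑-𝟘 (words ab m) (λ _ → refl))))

-- cd-polynomials and the basis c = a + b, e = a - b

monomialCoeff : ℚ × List AB → List AB → ℚ
monomialCoeff (q , v) w = if v ==W w then q else 0ℚ

coeff-∑ : ∀ p w → coeff p w ≡ ∑ℚ p (λ t → monomialCoeff t w)
coeff-∑ []            w = refl
coeff-∑ ((q , v) ∷ p) w = cong (monomialCoeff (q , v) w +q_) (coeff-∑ p w)

d→ab : AB → AB → ℚ
d→ab 𝐚 𝐛 = 1ℚ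
d→ab 𝐛 𝐚 = 1ℚ
d→ab _ _ = 0ℚ

cdCoeff : List CD → List AB → ℚ
cdCoeff []      []          = 1ℚ
cdCoeff []      (_ ∷ _)     = 0ℚ
cdCoeff (𝐜 ∷ m) []          = 0ℚ
cdCoeff (𝐜 ∷ m) (y ∷ w)     = cdCoeff m w
cdCoeff (𝐝 ∷ m) (y ∷ z ∷ w) = d→ab y z *q cdCoeff m w
cdCoeff (𝐝 ∷ m) _           = 0ℚ

∑-*P : ∀ (p P : NCPoly AB) (f : ℚ × List AB → ℚ) →
       ∑ℚ (p *P P) f ≡ ∑ℚ p (λ s → ∑ℚ P (λ t → f (proj₁ s *q proj₁ t , proj₂ s ++ proj₂ t)))
∑-*P p P f = trans (∑-concatMap _ p f) (∑-cong p (λ { (c , u) →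
  trans (∑-map _ P f) (∑-cong P (λ { (d , v) → refl })) }))

monomialCoeff-* : ∀ q d v w → monomialCoeff (q *q d , v) w ≡ q *q monomialCoeff (d , v) w
monomialCoeff-* q d v w with v ==W w
... | true  = refl
... | false = sym (ℚₚ.*-zeroʳ q)

coeff-expandMono : ∀ m w → ∑ℚ (expandMono m) (λ t → monomialCoeff t w) ≡ cdCoeff m w
coeff-expandMono []      []      = refl
coeff-expandMono []      (_ ∷ _) = refl
coeff-expandMono (x ∷ m) w       = trans (∑-*P (expandVar x) P (λ t → monomialCoeff t w)) (by-word x w)
  where
  P = expandMono m
  A : List AB → List AB → ℚ
  A u w = ∑ℚ P (λ t → monomialCoeff (1ℚ *q proj₁ t , u ++ proj₂ t) w)
  A[] : ∀ w → A [] w ≡ cdCoeff m w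
  A[] w = trans (∑-cong P (λ t → trans (monomialCoeff-* 1ℚ (proj₁ t) (proj₂ t) w) (ℚₚ.*-identityˡ _)))
                (coeff-expandMono m w)
  A≡0 : ∀ u w → (∀ t → monomialCoeff (1ℚ *q proj₁ t , u ++ proj₂ t) w ≡ 0ℚ) → A u w ≡ 0ℚ
  A≡0 u w = ∑-𝟘 P
  by-word : ∀ x w → ∑ℚ (expandVar x) (λ s → ∑ℚ P (λ t → monomialCoeff (proj₁ s *q proj₁ t , proj₂ s ++ proj₂ t) w))
                    ≡ cdCoeff (x ∷ m) w
  by-word 𝐜 []          = cong₂ (λ a b → a +q (b +q 0ℚ)) (A≡0 (𝐚 ∷ []) [] (λ _ → refl)) (A≡0 (𝐛 ∷ []) [] (λ _ → refl))
  by-word 𝐜 (𝐚 ∷ w)     = trans (cong₂ (λ a b → a +q (b +q 0ℚ)) (A[] w) (A≡0 (𝐛 ∷ []) (𝐚 ∷ w) (λ _ → refl)))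
                                (ℚₚ.+-identityʳ (cdCoeff m w))
  by-word 𝐜 (𝐛 ∷ w)     = trans (cong₂ (λ a b → a +q (b +q 0ℚ)) (A≡0 (𝐚 ∷ []) (𝐛 ∷ w) (λ _ → refl)) (A[] w))
                                (trans (ℚₚ.+-identityˡ (cdCoeff m w +q 0ℚ)) (ℚₚ.+-identityʳ (cdCoeff m w)))
  by-word 𝐝 []          = cong₂ (λ a b → a +q (b +q 0ℚ)) (A≡0 (𝐚 ∷ 𝐛 ∷ []) [] (λ _ → refl))
                                                          (A≡0 (𝐛 ∷ 𝐚 ∷ []) [] (λ _ → refl))
  by-word 𝐝 (𝐚 ∷ [])    = cong₂ (λ a b → a +q (b +q 0ℚ)) (A≡0 (𝐚 ∷ 𝐛 ∷ []) (𝐚 ∷ []) (λ _ → refl))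
                                                          (A≡0 (𝐛 ∷ 𝐚 ∷ []) (𝐚 ∷ []) (λ _ → refl))
  by-word 𝐝 (𝐛 ∷ [])    = cong₂ (λ a b → a +q (b +q 0ℚ)) (A≡0 (𝐚 ∷ 𝐛 ∷ []) (𝐛 ∷ []) (λ _ → refl))
                                                          (A≡0 (𝐛 ∷ 𝐚 ∷ []) (𝐛 ∷ []) (λ _ → refl))
  by-word 𝐝 (𝐚 ∷ 𝐚 ∷ w) = trans (cong₂ (λ a b → a +q (b +q 0ℚ)) (A≡0 (𝐚 ∷ 𝐛 ∷ []) (𝐚 ∷ 𝐚 ∷ w) (λ _ → refl))
                                                                 (A≡0 (𝐛 ∷ 𝐚 ∷ []) (𝐚 ∷ 𝐚 ∷ w) (λ _ → refl)))
                                (sym (ℚₚ.*-zeroˡ (cdCoeff m w)))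
  by-word 𝐝 (𝐚 ∷ 𝐛 ∷ w) = trans (cong₂ (λ a b → a +q (b +q 0ℚ)) (A[] w) (A≡0 (𝐛 ∷ 𝐚 ∷ []) (𝐚 ∷ 𝐛 ∷ w) (λ _ → refl)))
                                (trans (ℚₚ.+-identityʳ (cdCoeff m w)) (sym (ℚₚ.*-identityˡ (cdCoeff m w))))
  by-word 𝐝 (𝐛 ∷ 𝐚 ∷ w) = trans (cong₂ (λ a b → a +q (b +q 0ℚ)) (A≡0 (𝐚 ∷ 𝐛 ∷ []) (𝐛 ∷ 𝐚 ∷ w) (λ _ → refl)) (A[] w))
                                (trans (ℚₚ.+-identityˡ (cdCoeff m w +q 0ℚ))
                                  (trans (ℚₚ.+-identityʳ (cdCoeff m w)) (sym (ℚₚ.*-identityˡ (cdCoeff m w)))))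
  by-word 𝐝 (𝐛 ∷ 𝐛 ∷ w) = trans (cong₂ (λ a b → a +q (b +q 0ℚ)) (A≡0 (𝐚 ∷ 𝐛 ∷ []) (𝐛 ∷ 𝐛 ∷ w) (λ _ → refl))
                                                                 (A≡0 (𝐛 ∷ 𝐚 ∷ []) (𝐛 ∷ 𝐛 ∷ w) (λ _ → refl)))
                                (sym (ℚₚ.*-zeroˡ (cdCoeff m w)))

cdTerm : List AB → ℚ × List CD → ℚ
cdTerm w (q , m) = q *q cdCoeff m w

coeff-expandCD : ∀ Φ w → coeff (expandCD Φ) w ≡ ∑ℚ Φ (cdTerm w)
coeff-expandCD Φ w = trans (coeff-∑ (expandCD Φ) w) (trans (∑-concatMap _ Φ _) (∑-cong Φ (λ { (q , m) → begin
  ∑ℚ (((q , []) ∷ []) *P expandMono m) (λ t → monomialCoeff t w)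
    ≡⟨ ∑-*P ((q , []) ∷ []) (expandMono m) (λ t → monomialCoeff t w) ⟩
  ∑ℚ (expandMono m) (λ t → monomialCoeff (q *q proj₁ t , proj₂ t) w) +q 0ℚ
    ≡⟨ ℚₚ.+-identityʳ _ ⟩
  ∑ℚ (expandMono m) (λ t → monomialCoeff (q *q proj₁ t , proj₂ t) w)
    ≡⟨ ∑-cong (expandMono m) (λ t → monomialCoeff-* q (proj₁ t) (proj₂ t) w) ⟩
  ∑ℚ (expandMono m) (λ t → q *q monomialCoeff t w)
    ≡⟨ ∑-⊗ˡ (expandMono m) q _ ⟩
  q *q ∑ℚ (expandMono m) (λ t → monomialCoeff t w)
    ≡⟨ cong (q *q_) (coeff-expandMono m w) ⟩
  q *q cdCoeff m w  ∎ })))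
  where open ≡-Reasoning

data CE : Set where
  𝐜 𝐞 : CE

ce : List CE
ce = 𝐜 ∷ 𝐞 ∷ []

-- c = a + b and e = a - b.
ce→ab : CE → AB → ℚ
ce→ab 𝐜 _ = 1ℚ
ce→ab 𝐞 𝐚 = 1ℚ
ce→ab 𝐞 𝐛 = -q 1ℚ

good : List CE → Bool
good []          = true
good (𝐜 ∷ T)     = good T
good (𝐞 ∷ 𝐞 ∷ T) = good T
good (𝐞 ∷ _)     = false

-- e² = c² - 2d
ceToCD : List CE → NCPoly CD
ceToCD []          = (1ℚ , []) ∷ []
ceToCD (𝐜 ∷ T)     = map (λ (q , m) → q , 𝐜 ∷ m) (ceToCD T)
ceToCD (𝐞 ∷ 𝐞 ∷ T) = map (λ (q , m) → q , 𝐜 ∷ 𝐜 ∷ m) (ceToCD T) ++ map (λ (q , m) → -q (1ℚ +q 1ℚ) *q q , 𝐝 ∷ m) (ceToCD T)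
ceToCD (𝐞 ∷ _)     = []

coeff-ceToCD : ∀ T w → good T ≡ true → ∑ℚ (ceToCD T) (cdTerm w) ≡ letterwise ce→ab T w
coeff-ceToCD []      []      _      = refl
coeff-ceToCD []      (_ ∷ _) _      = refl
coeff-ceToCD (𝐜 ∷ T) []      good-T = trans (∑-map _ (ceToCD T) _) (∑-𝟘 (ceToCD T) (λ (q , m) → ℚₚ.*-zeroʳ q))
coeff-ceToCD (𝐜 ∷ T) (y ∷ w) good-T =
  trans (∑-map _ (ceToCD T) _) (trans (coeff-ceToCD T w good-T) (sym (ℚₚ.*-identityˡ _)))
coeff-ceToCD (𝐞 ∷ 𝐞 ∷ T) w good-T =
  trans (∑-++ (map _ (ceToCD T)) _ _) (trans (cong₂ _+q_ (∑-map _ (ceToCD T) _) (∑-map _ (ceToCD T) _)) (by-word w))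
  where
  -2ℚ = -q (1ℚ +q 1ℚ)
  S = λ w → ∑ℚ (ceToCD T) (cdTerm w)
  by-word : ∀ w → ∑ℚ (ceToCD T) (λ (q , m) → q *q cdCoeff (𝐜 ∷ 𝐜 ∷ m) w)
                  +q ∑ℚ (ceToCD T) (λ (q , m) → (-2ℚ *q q) *q cdCoeff (𝐝 ∷ m) w)
                  ≡ letterwise ce→ab (𝐞 ∷ 𝐞 ∷ T) w
  by-word []          = cong₂ _+q_ (∑-𝟘 (ceToCD T) (λ (q , m) → ℚₚ.*-zeroʳ q))
                                   (∑-𝟘 (ceToCD T) (λ (q , m) → ℚₚ.*-zeroʳ (-2ℚ *q q)))
  by-word (y ∷ [])    = trans (cong₂ _+q_ (∑-𝟘 (ceToCD T) (λ (q , m) → ℚₚ.*-zeroʳ q))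
                                          (∑-𝟘 (ceToCD T) (λ (q , m) → ℚₚ.*-zeroʳ (-2ℚ *q q))))
                              (sym (ℚₚ.*-zeroʳ (ce→ab 𝐞 y)))
  by-word (y ∷ z ∷ w) = begin
    S w +q ∑ℚ (ceToCD T) (λ (q , m) → (-2ℚ *q q) *q (d→ab y z *q cdCoeff m w))
      ≡⟨ cong (S w +q_) (∑-cong (ceToCD T) (λ (q , m) → interchange -2ℚ q (d→ab y z) (cdCoeff m w))) ⟩
    S w +q ∑ℚ (ceToCD T) (λ (q , m) → (-2ℚ *q d→ab y z) *q (q *q cdCoeff m w))
      ≡⟨ cong (S w +q_) (∑-⊗ˡ (ceToCD T) (-2ℚ *q d→ab y z) (cdTerm w)) ⟩
    S w +q (-2ℚ *q d→ab y z) *q S w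
      ≡⟨ cong (_+q (-2ℚ *q d→ab y z) *q S w) (sym (ℚₚ.*-identityˡ (S w))) ⟩
    1ℚ *q S w +q (-2ℚ *q d→ab y z) *q S w
      ≡⟨ sym (ℚₚ.*-distribʳ-+ (S w) 1ℚ (-2ℚ *q d→ab y z)) ⟩
    (1ℚ +q -2ℚ *q d→ab y z) *q S w
      ≡⟨ cong₂ _*q_ (e²≡c²-2d y z) (coeff-ceToCD T w good-T) ⟩
    (ce→ab 𝐞 y *q ce→ab 𝐞 z) *q letterwise ce→ab T w
      ≡⟨ ℚₚ.*-assoc (ce→ab 𝐞 y) (ce→ab 𝐞 z) _ ⟩
    letterwise ce→ab (𝐞 ∷ 𝐞 ∷ T) (y ∷ z ∷ w)  ∎
    where
    open ≡-Reasoning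
    interchange = CommutativeSemigroupProperties.interchange (CommutativeRing.*-commutativeSemigroup ℚₚ.+-*-commutativeRing)
    e²≡c²-2d : ∀ y z → 1ℚ +q -2ℚ *q d→ab y z ≡ ce→ab 𝐞 y *q ce→ab 𝐞 z
    e²≡c²-2d 𝐚 𝐚 = refl
    e²≡c²-2d 𝐚 𝐛 = refl
    e²≡c²-2d 𝐛 𝐚 = refl
    e²≡c²-2d 𝐛 𝐛 = refl

-- a - b = e and b = (c - e)/2.
ζ→ce : AB → CE → ℚ
ζ→ce 𝐚 𝐜 = 0ℚ
ζ→ce 𝐚 𝐞 = 1ℚ
ζ→ce 𝐛 𝐜 = ½
ζ→ce 𝐛 𝐞 = -q ½

ζ→ce→ab : ∀ x z → ∑ℚ ce (λ y → ζ→ce x y *q ce→ab y z) ≡ ζ→ab x z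
ζ→ce→ab 𝐚 𝐚 = refl
ζ→ce→ab 𝐚 𝐛 = refl
ζ→ce→ab 𝐛 𝐚 = refl
ζ→ce→ab 𝐛 𝐛 = refl

replicate-𝐞-++ : ∀ j T → replicate j 𝐞 ++ 𝐞 ∷ T ≡ replicate (suc j) 𝐞 ++ T
replicate-𝐞-++ zero    T = refl
replicate-𝐞-++ (suc j) T = cong (𝐞 ∷_) (replicate-𝐞-++ j T)

good-𝐞^ : ∀ j → good (replicate j 𝐞 ++ []) ≡ even j
good-𝐞^ zero          = refl
good-𝐞^ (suc zero)    = refl
good-𝐞^ (suc (suc j)) = good-𝐞^ j

good-𝐞^-𝐜 : ∀ j T → good (replicate j 𝐞 ++ 𝐜 ∷ T) ≡ even j ∧ good T
good-𝐞^-𝐜 zero          T = refl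
good-𝐞^-𝐜 (suc zero)    T = refl
good-𝐞^-𝐜 (suc (suc j)) T = good-𝐞^-𝐜 j T

-- The ce-coefficients of Ψ

module CESeries {n : ℕ} (B : Subset n → Bool) where

  open DiscreteSeries B

  ceSeries : ℕ → List CE → 𝔸 n
  ceSeries r T = ∑ (words ab (length T)) (λ u → const (letterwise ζ→ce u T) ⊗ ∏ˡ Zₐ (composition r u))

  const*⊗ : ∀ p q (x y : 𝔸 n) → const (p *q q) ⊗ (x ⊗ y) ≡ const p ⊗ (x ⊗ (const q ⊗ y))
  const*⊗ p q x y = begin
    const (p *q q) ⊗ (x ⊗ y)         ≡⟨ cong (_⊗ (x ⊗ y)) (const-* p q) ⟩
    (const p ⊗ const q) ⊗ (x ⊗ y)    ≡⟨ ⊗-assoc (const p) (const q) (x ⊗ y) ⟩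
    const p ⊗ (const q ⊗ (x ⊗ y))    ≡⟨ cong (const p ⊗_) (⊗-swap (const q) x y) ⟩
    const p ⊗ (x ⊗ (const q ⊗ y))    ∎
    where open ≡-Reasoning

  ceSeries-[] : ∀ r → ceSeries r [] ≡ Zₐ r
  ceSeries-[] r = trans (⊕-identityʳ _) (trans (⊗-identityˡ _) (⊗-identityʳ (Zₐ r)))

  ceSeries-𝐜 : ∀ r T → ceSeries r (𝐜 ∷ T) ≡ const ½ ⊗ (Zₐ r ⊗ ceSeries 1 T)
  ceSeries-𝐜 r T = begin
    ceSeries r (𝐜 ∷ T)
      ≡⟨ ∑-words-ab (length T) _ ⟩
    ∑ (words ab (length T)) (λ u → const (0ℚ *q L u) ⊗ ∏ˡ Zₐ (composition (suc r) u))
      ⊕ ∑ (words ab (length T)) (λ u → const (½ *q L u) ⊗ (Zₐ r ⊗ ∏ˡ Zₐ (composition 1 u)))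
      ≡⟨ cong₂ _⊕_ (∑-𝟘 (words ab (length T)) (λ u →
                      trans (cong (λ q → const q ⊗ ∏ˡ Zₐ (composition (suc r) u)) (ℚₚ.*-zeroˡ (L u)))
                            (trans (cong (_⊗ ∏ˡ Zₐ (composition (suc r) u)) const-0) (⊗-zeroˡ _))))
                   (∑-cong (words ab (length T)) (λ u → const*⊗ ½ (L u) (Zₐ r) _)) ⟩
    𝟘 ⊕ ∑ (words ab (length T)) (λ u → const ½ ⊗ (Zₐ r ⊗ (const (L u) ⊗ ∏ˡ Zₐ (composition 1 u))))
      ≡⟨ ⊕-identityˡ _ ⟩
    ∑ (words ab (length T)) (λ u → const ½ ⊗ (Zₐ r ⊗ (const (L u) ⊗ ∏ˡ Zₐ (composition 1 u))))
      ≡⟨ trans (∑-⊗ˡ (words ab (length T)) (const ½) _) (cong (const ½ ⊗_) (∑-⊗ˡ (words ab (length T)) (Zₐ r) _)) ⟩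
    const ½ ⊗ (Zₐ r ⊗ ceSeries 1 T)  ∎
    where
    open ≡-Reasoning
    L = λ u → letterwise ζ→ce u T

  ceSeries-𝐞 : ∀ r T → ceSeries r (𝐞 ∷ T) ≡ ceSeries (suc r) T ⊕ const (-q ½) ⊗ (Zₐ r ⊗ ceSeries 1 T)
  ceSeries-𝐞 r T = begin
    ceSeries r (𝐞 ∷ T)
      ≡⟨ ∑-words-ab (length T) _ ⟩
    ∑ (words ab (length T)) (λ u → const (1ℚ *q L u) ⊗ ∏ˡ Zₐ (composition (suc r) u))
      ⊕ ∑ (words ab (length T)) (λ u → const (-q ½ *q L u) ⊗ (Zₐ r ⊗ ∏ˡ Zₐ (composition 1 u)))
      ≡⟨ cong₂ _⊕_ (∑-cong (words ab (length T)) (λ u →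
                      cong (λ q → const q ⊗ ∏ˡ Zₐ (composition (suc r) u)) (ℚₚ.*-identityˡ (L u))))
                   (∑-cong (words ab (length T)) (λ u → const*⊗ (-q ½) (L u) (Zₐ r) _)) ⟩
    ceSeries (suc r) T
      ⊕ ∑ (words ab (length T)) (λ u → const (-q ½) ⊗ (Zₐ r ⊗ (const (L u) ⊗ ∏ˡ Zₐ (composition 1 u))))
      ≡⟨ cong (ceSeries (suc r) T ⊕_) (trans (∑-⊗ˡ (words ab (length T)) (const (-q ½)) _)
                                             (cong (const (-q ½) ⊗_) (∑-⊗ˡ (words ab (length T)) (Zₐ r) _))) ⟩
    ceSeries (suc r) T ⊕ const (-q ½) ⊗ (Zₐ r ⊗ ceSeries 1 T)  ∎
    where
    open ≡-Reasoning
    L = λ u → letterwise ζ→ce u T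

  ceSeries-𝐞^ : ∀ {T} {t : 𝔸 n} → (∀ r → ceSeries r T ≡ Zₐ r ⊗ t) →
                ∀ j r → ceSeries r (replicate j 𝐞 ++ T) ≡ h r j ⊗ t
  ceSeries-𝐞^          hyp zero    r = hyp r
  ceSeries-𝐞^ {T} {t} hyp (suc j) r = begin
    ceSeries r (𝐞 ∷ E)
      ≡⟨ ceSeries-𝐞 r E ⟩
    ceSeries (suc r) E ⊕ c ⊗ (Zₐ r ⊗ ceSeries 1 E)
      ≡⟨ cong₂ (λ a b → a ⊕ c ⊗ (Zₐ r ⊗ b)) (ceSeries-𝐞^ hyp j (suc r)) (ceSeries-𝐞^ hyp j 1) ⟩
    h (suc r) j ⊗ t ⊕ c ⊗ (Zₐ r ⊗ (h 1 j ⊗ t))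
      ≡⟨ cong (h (suc r) j ⊗ t ⊕_) (trans (cong (c ⊗_) (sym (⊗-assoc (Zₐ r) (h 1 j) t)))
                                          (sym (⊗-assoc c (Zₐ r ⊗ h 1 j) t))) ⟩
    h (suc r) j ⊗ t ⊕ (c ⊗ (Zₐ r ⊗ h 1 j)) ⊗ t
      ≡⟨ sym (⊗-distribʳ t (h (suc r) j) _) ⟩
    h r (suc j) ⊗ t  ∎
    where
    open ≡-Reasoning
    E = replicate j 𝐞 ++ T
    c = const (-q ½)

  ceSeries-𝐞^-[] : ∀ j → ceSeries 1 (replicate j 𝐞 ++ []) ≡ h 1 j ⊗ 𝟙
  ceSeries-𝐞^-[] j = ceSeries-𝐞^ (λ r → trans (ceSeries-[] r) (sym (⊗-identityʳ (Zₐ r)))) j 1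

  ceSeries-𝐞^-𝐜 : ∀ j T → ceSeries 1 (replicate j 𝐞 ++ 𝐜 ∷ T) ≡ h 1 j ⊗ (const ½ ⊗ ceSeries 1 T)
  ceSeries-𝐞^-𝐜 j T = ceSeries-𝐞^ (λ r → trans (ceSeries-𝐜 r T) (⊗-swap (const ½) (Zₐ r) (ceSeries 1 T))) j 1

  at-ceSeries : ∀ T → ceSeries 1 T at ⊤ ≡
                ∑ℚ (words ab (length T)) (λ u → ι (+ ζ B (composition 1 u)) *q letterwise ζ→ce u T)
  at-ceSeries T = trans (at-∑ (words ab (length T)) (λ u → const (L u) ⊗ ∏ˡ Zₐ (composition 1 u)) ⊤)
                        (∑-cong (words ab (length T)) λ u →
    trans (at-const⊗ (L u) (∏ˡ Zₐ (composition 1 u)) ⊤)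
          (trans (cong (L u *q_) (sym (ι-ζ B (composition 1 u)))) (ℚₚ.*-comm (L u) (ι (+ ζ B (composition 1 u))))))
    where L = λ u → letterwise ζ→ce u T

  module _ (eulerian : Eulerian B) where

    ceSeries-bad : ∀ j T → good (replicate j 𝐞 ++ T) ≡ false → ceSeries 1 (replicate j 𝐞 ++ T) ≡ 𝟘
    ceSeries-bad j []      bad = begin
      ceSeries 1 (replicate j 𝐞 ++ [])  ≡⟨ ceSeries-𝐞^-[] j ⟩
      h 1 j ⊗ 𝟙                         ≡⟨ cong (_⊗ 𝟙) (h₁-odd≡𝟘 eulerian j (trans (sym (good-𝐞^ j)) bad)) ⟩
      𝟘 ⊗ 𝟙                             ≡⟨ ⊗-zeroˡ 𝟙 ⟩
      𝟘                                 ∎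
      where open ≡-Reasoning
    ceSeries-bad j (𝐞 ∷ T) bad = subst (λ S → ceSeries 1 S ≡ 𝟘) (sym (replicate-𝐞-++ j T))
      (ceSeries-bad (suc j) T (subst (λ S → good S ≡ false) (replicate-𝐞-++ j T) bad))
    ceSeries-bad j (𝐜 ∷ T) bad = trans (ceSeries-𝐞^-𝐜 j T) (by-parity (even j) refl)
      where
      by-parity : ∀ b → even j ≡ b → h 1 j ⊗ (const ½ ⊗ ceSeries 1 T) ≡ 𝟘
      by-parity false odd-j  = trans (cong (_⊗ _) (h₁-odd≡𝟘 eulerian j odd-j)) (⊗-zeroˡ _)
      by-parity true  even-j = begin
        h 1 j ⊗ (const ½ ⊗ ceSeries 1 T)  ≡⟨ cong (λ s → h 1 j ⊗ (const ½ ⊗ s)) (ceSeries-bad 0 T bad-T) ⟩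
        h 1 j ⊗ (const ½ ⊗ 𝟘)             ≡⟨ cong (h 1 j ⊗_) (zeroʳ (const ½)) ⟩
        h 1 j ⊗ 𝟘                         ≡⟨ zeroʳ (h 1 j) ⟩
        𝟘                                 ∎
        where
        open ≡-Reasoning
        bad-T : good T ≡ false
        bad-T = trans (sym (cong (_∧ good T) even-j)) (trans (sym (good-𝐞^-𝐜 j T)) bad)

module CDIndex {m : ℕ} (B : Subset (suc m) → Bool) (eulerian : Eulerian B) where

  open CESeries B

  -- The coefficient of the ce-word T in Ψ.
  κ : List CE → ℚ
  κ T = ceSeries 1 T at ⊤

  κ-bad : ∀ T → good T ≡ false → κ T ≡ 0ℚ
  κ-bad T bad = trans (cong (_at ⊤) (ceSeries-bad eulerian 0 T bad)) (at-𝟘 {suc m} ⊤)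

  Φ : NCPoly CD
  Φ = concatMap (λ T → map (λ (q , mono) → κ T *q q , mono) (ceToCD T)) (filterᵇ good (words ce m))

  coeff-Φ : ∀ w → coeff (expandCD Φ) w ≡ ∑ℚ (words ce m) (λ T → κ T *q letterwise ce→ab T w)
  coeff-Φ w = begin
    coeff (expandCD Φ) w
      ≡⟨ coeff-expandCD Φ w ⟩
    ∑ℚ Φ (cdTerm w)
      ≡⟨ ∑-concatMap _ (filterᵇ good (words ce m)) (cdTerm w) ⟩
    ∑ℚ (filterᵇ good (words ce m)) (λ T → ∑ℚ (scaled T) (cdTerm w))
      ≡⟨ ∑-filterᵇ good (words ce m) _ ⟩
    ∑ℚ (words ce m) (λ T → if good T then ∑ℚ (scaled T) (cdTerm w) else 0ℚ)
      ≡⟨ ∑-cong (words ce m) (λ T → by-goodness T (good T) refl) ⟩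
    ∑ℚ (words ce m) (λ T → κ T *q letterwise ce→ab T w)  ∎
    where
    open ≡-Reasoning
    scaled = λ T → map (λ (q , mono) → κ T *q q , mono) (ceToCD T)
    by-goodness : ∀ T b → good T ≡ b →
                  (if b then ∑ℚ (scaled T) (cdTerm w) else 0ℚ) ≡ κ T *q letterwise ce→ab T w
    by-goodness T true  good-T = begin
      ∑ℚ (scaled T) (cdTerm w)                                     ≡⟨ ∑-map _ (ceToCD T) (cdTerm w) ⟩
      ∑ℚ (ceToCD T) (λ (q , mono) → (κ T *q q) *q cdCoeff mono w)  ≡⟨ ∑-cong (ceToCD T) (λ (q , mono) →
                                                                        ℚₚ.*-assoc (κ T) q (cdCoeff mono w)) ⟩
      ∑ℚ (ceToCD T) (λ t → κ T *q cdTerm w t)                      ≡⟨ ∑-⊗ˡ (ceToCD T) (κ T) (cdTerm w) ⟩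
      κ T *q ∑ℚ (ceToCD T) (cdTerm w)                              ≡⟨ cong (κ T *q_) (coeff-ceToCD T w good-T) ⟩
      κ T *q letterwise ce→ab T w                                  ∎
    by-goodness T false bad-T = sym (trans (cong (_*q letterwise ce→ab T w) (κ-bad T bad-T))
                                           (ℚₚ.*-zeroˡ (letterwise ce→ab T w)))

  -- Ψ = ∑_u ζ(u) ∏ᵢ (uᵢ = 𝐚 ? e : (c - e)/2), expanded in the ce-words.
  ∑-κ : ∀ w → ∑ℚ (words ce m) (λ T → κ T *q letterwise ce→ab T w) ≡ coeff (Ψ B) w
  ∑-κ w = begin
    ∑ℚ (words ce m) (λ T → κ T *q letterwise ce→ab T w)
      ≡⟨ ∑-words-cong ce m (λ T ∣T∣≡m → cong (_*q letterwise ce→ab T w)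
           (trans (at-ceSeries T) (cong (λ k → ∑ℚ (words ab k) (λ u → ζu u *q letterwise ζ→ce u T)) ∣T∣≡m))) ⟩
    ∑ℚ (words ce m) (λ T → ∑ℚ (words ab m) (λ u → ζu u *q letterwise ζ→ce u T) *q letterwise ce→ab T w)
      ≡⟨ ∑-cong (words ce m) (λ T → trans (sym (∑-⊗ʳ (words ab m) (letterwise ce→ab T w) _))
           (∑-cong (words ab m) (λ u → ℚₚ.*-assoc (ζu u) _ _))) ⟩
    ∑ℚ (words ce m) (λ T → ∑ℚ (words ab m) (λ u → ζu u *q (letterwise ζ→ce u T *q letterwise ce→ab T w)))
      ≡⟨ ∑-comm (words ce m) (words ab m) _ ⟩
    ∑ℚ (words ab m) (λ u → ∑ℚ (words ce m) (λ T → ζu u *q (letterwise ζ→ce u T *q letterwise ce→ab T w)))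
      ≡⟨ ∑-words-cong ab m (λ u ∣u∣≡m → trans (∑-⊗ˡ (words ce m) (ζu u) _) (cong (ζu u *q_)
           (trans (∑-letterwise ζ→ce ce→ab ce m u w ∣u∣≡m) (letterwise-cong ζ→ce→ab u w)))) ⟩
    ∑ℚ (words ab m) (λ u → ζu u *q letterwise ζ→ab u w)
      ≡⟨ sym (coeff-Ψ m B w) ⟩
    coeff (Ψ B) w  ∎
    where
    open ≡-Reasoning
    ζu = λ u → ι (+ ζ B (composition 1 u))

theorem7 : (n : ℕ) (B : Subset n → Bool) → IsBuildingSet B → Eulerian B →
    Σ (NCPoly CD) (λ Φ → ∀ (w : List AB) → coeff (expandCD Φ) w ≡ coeff (Ψ B) w)
theorem7 zero    B _ _        = ((1ℚ , []) ∷ []) , λ { [] → refl ; (_ ∷ _) → refl }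
theorem7 (suc m) B _ eulerian = Φ , λ w → trans (coeff-Φ w) (∑-κ w)
  where open CDIndex B eulerian
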